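{- Let $n\ge 3$. Then $Z(\mathcal P_n,i)=(i-1)^{\lfloor\frac{n-1}{2}\rfloor}\mathcal P_n\!\left(\frac{1}{i-1}\right)$ for every integer $i\ge 2$. Furthermore, for all $i\ge2$, $$Z(\mathcal P_{n+1},i)=i\,Z(\mathcal P_n,i)-\varepsilon(n)\frac{2(i-1)^{\frac12(n+1)}}{n+1}\binom{n-1}{\frac12(n-1)},$$ where $\varepsilon(n)=0$ if $n$ is even and $\varepsilon(n)=1$ if $n$ is odd (the second term being $0$ when $n$ is even), and $Z(\mathcal P_3,i)=i$.
   Context: $[n]=\{1,\dots,n\}$; $\mathfrak S_n$ is the set of permutations of $[n]$ in one-line notation. The circular peak set of $\sigma\in\mathfrak S_n$ is $CP(\sigma)=\{\sigma(i)\mid 2\le i\le n-1,\ \sigma(i-1)<\sigma(i)>\sigma(i+1)\}$; for $S\subseteq[n]$, $CP_n(S)=\{\sigma\in\mathfrak S_n\mid CP(\sigma)=S\}$, and $\mathcal P_n=\{S\subseteq[n]\mid CP_n(S)\neq\emptyset\}$, a poset under inclusion. For $i\ge-1$, $p_{n,i}$ is the number of $S\in\mathcal P_n$ with $|S|=i+1$. The f-polynomial of $\mathcal P_n$ is $\mathcal P_n(x)=\sum_{i=0}^{\lfloor\frac{n-1}{2}\rfloor}p_{n,i-1}x^{\lfloor\frac{n-1}{2}\rfloor-i}$. For a finite poset $P$ and integer $i\ge2$, the zeta polynomial $Z(P,i)$ is the number of multichains $x_1\le x_2\le\cdots\le x_{i-1}$ in $P$. -}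

module Defs where

open import Data.Bool using (Bool; true; false; _∧_; _∨_; if_then_else_)
import Data.Bool as Bool
open import Data.Nat as ℕ using (ℕ; zero; suc; _∸_; _<ᵇ_; _≡ᵇ_)
open import Data.Nat.DivMod using (_/_)
open import Data.Nat.Combinatorics using (_C_)
open import Data.Fin using (Fin)
open import Data.Fin.Subset using (Subset; ⊥; ⁅_⁆; _∪_; ∣_∣)
open import Data.Fin.Subset.Properties using (_⊆?_)
open import Data.Vec using (Vec; []; _∷_)
open import Data.Vec.Properties using (≡-dec)
open import Data.List using (List; []; _∷_; _++_; map; concatMap; foldr; filterᵇ; length; allFin; upTo)
open import Data.Bool.ListAction using (any)
open import Data.Integer using (+_)
open import Data.Rational using (ℚ; 0ℚ; 1ℚ; _+_; _*_) renaming (_/_ to _÷ℚ_)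
open import Relation.Nullary using (does)

-- Permutations of [n].
-- The value k ∈ [n] is encoded by the element (k-1) : Fin n.
-- A permutation in one-line notation is a list (σ(1), …, σ(n)).

insertions : {A : Set} → A → List A → List (List A)
insertions x []       = (x ∷ []) ∷ []
insertions x (y ∷ ys) = (x ∷ y ∷ ys) ∷ map (y ∷_) (insertions x ys)

orderings : {A : Set} → List A → List (List A)
orderings []       = [] ∷ []
orderings (x ∷ xs) = concatMap (insertions x) (orderings xs)

Sym : (n : ℕ) → List (List (Fin n))
Sym n = orderings (allFin n)

_<F_ : {n : ℕ} → Fin n → Fin n → Bool
a <F b = Data.Fin.toℕ a <ᵇ Data.Fin.toℕ b

peakValues : {n : ℕ} → List (Fin n) → List (Fin n)
peakValues (a ∷ b ∷ c ∷ rest) =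
  (if (a <F b) ∧ (c <F b) then b ∷ [] else []) ++ peakValues (b ∷ c ∷ rest)
peakValues _ = []

CP : {n : ℕ} → List (Fin n) → Subset n
CP σ = foldr (λ v S → ⁅ v ⁆ ∪ S) ⊥ (peakValues σ)

allSubsets : (n : ℕ) → List (Subset n)
allSubsets zero    = [] ∷ []
allSubsets (suc n) = map (true ∷_) (allSubsets n) ++ map (false ∷_) (allSubsets n)

_≟S_ : {n : ℕ} → (S T : Subset n) → Bool
S ≟S T = does (≡-dec Bool._≟_ S T)

𝒫 : (n : ℕ) → List (Subset n)
𝒫 n = filterᵇ (λ S → any (λ σ → CP σ ≟S S) (Sym n)) (allSubsets n)

-- pcount n k = p_{n,k-1} = #{ S ∈ 𝒫ₙ | |S| = k }
pcount : ℕ → ℕ → ℕ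
pcount n k = length (filterᵇ (λ S → ∣ S ∣ ≡ᵇ k) (𝒫 n))

sequences : {A : Set} → List A → ℕ → List (List A)
sequences L zero    = [] ∷ []
sequences L (suc k) = concatMap (λ x → map (x ∷_) (sequences L k)) L

isMultichain : {n : ℕ} → List (Subset n) → Bool
isMultichain (x ∷ y ∷ r) = does (x ⊆? y) ∧ isMultichain (y ∷ r)
isMultichain _           = true

-- Z(𝒫ₙ, i) (meaningful for i ≥ 2)
Z : (n i : ℕ) → ℕ
Z n i = length (filterᵇ isMultichain (sequences (𝒫 n) (i ∸ 1)))

ℕ→ℚ : ℕ → ℚ
ℕ→ℚ k = (+ k) ÷ℚ 1

_^ℚ_ : ℚ → ℕ → ℚ
x ^ℚ zero  = 1ℚ
x ^ℚ suc k = x * (x ^ℚ k)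

-- reciprocal 1/k of a positive natural k (value at 0 is an irrelevant 0)
recip : ℕ → ℚ
recip zero    = 0ℚ
recip (suc k) = (+ 1) ÷ℚ (suc k)

sumℚ : List ℚ → ℚ
sumℚ = foldr _+_ 0ℚ

m : ℕ → ℕ
m n = (n ∸ 1) / 2

fpoly : ℕ → ℚ → ℚ
fpoly n x = sumℚ (map (λ i → ℕ→ℚ (pcount n i) * (x ^ℚ (m n ∸ i))) (upTo (suc (m n))))

ε : ℕ → ℕ
ε zero          = 0
ε (suc zero)    = 1
ε (suc (suc n)) = ε n

-- ε(n) · 2 (i-1)^{(n+1)/2} / (n+1) · binom(n-1, (n-1)/2)
-- (exponent written ⌊(n+1)/2⌋, which equals (n+1)/2 whenever ε(n) = 1)
correction : ℕ → ℕ → ℚ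
correction n i =
  (+ (ε n ℕ.* (2 ℕ.* ((i ∸ 1) ℕ.^ ((n ℕ.+ 1) / 2)) ℕ.* ((n ∸ 1) C ((n ∸ 1) / 2))))) ÷ℚ (suc n)

module Submission where

-- A set S ⊆ [n] is a circular peak set iff its j-th smallest element is at least 2j + 1.  The
-- permutation interleaving the non-members with the members, both increasing, realises such an S;
-- conversely, below a peak v lie the smaller peaks, the left neighbours of all peaks up to v and
-- the right neighbour of the last of these, all distinct.  So 𝒫ₙ is a down-set, and a multichain
-- of length i - 1 in it with top S amounts to choosing, for each element of S, the step at which
-- it enters: Z(𝒫ₙ, i) is the sum of (i - 1) ^ |S| over S ∈ 𝒫ₙ, which is the f-polynomial identity.
-- Adjoining n + 1 to an admissible S ⊆ [n] keeps it admissible unless n = 2|S| + 1; these maximal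
-- sets are counted by the reflection principle and number Catalan((n - 1)/2), which gives the
-- correction term.

open import Defs

module Combinatorics where

  open import Data.Bool using (Bool; true; false; _∧_; if_then_else_; T; T?)
  import Data.Bool as Bool
  open import Data.Bool.Properties using (∧-zeroʳ)
  open import Data.Bool.ListAction using (any)
  open import Data.Empty using (⊥; ⊥-elim)
  open import Data.Fin using (Fin; toℕ) renaming (zero to fzero; suc to fsuc)
  open import Data.Fin.Properties using (toℕ<n; toℕ-injective)
  open import Data.Fin.Subset using (Subset; ⁅_⁆; _∪_; ∣_∣) renaming (⊥ to ∅; _∈_ to _∈ₛ_)
  open import Data.Fin.Subset.Properties using (_⊆?_; ∪-identityˡ; ∉⊥; x∈⁅y⁆⇒x≡y; x∈p∪q⁻)
  open import Data.List using (List; []; _∷_; _++_; map; concatMap; foldr; allFin; filterᵇ; length; upTo)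
  open import Data.List.Membership.Propositional using (_∈_; find; lose)
  open import Data.List.Membership.Propositional.Properties
    using (∈-concatMap⁺; ∈-concatMap⁻; ∈-map⁺; ∈-map⁻; ∈-∃++)
  open import Data.List.Properties
    using (map-++; map-tabulate; map-∘; map-injective; map-applyUpTo; length-++; filter-++)
  open import Data.List.Relation.Binary.Permutation.Propositional
    using (_↭_; ↭-refl; ↭-sym; ↭-trans; ↭-reflexive; prep; swap)
  open import Data.List.Relation.Binary.Permutation.Propositional.Properties
    using (drop-mid; ∈-resp-↭; ↭-empty-inv; shift; ++-comm) renaming (map⁺ to ↭-map⁺)
  open import Data.List.Relation.Unary.All using (All)
  import Data.List.Relation.Unary.All as All
  open import Data.List.Relation.Unary.All.Properties using (all-filter)
  open import Data.List.Relation.Unary.Any using (here; there)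
  open import Data.List.Relation.Unary.Any.Properties using (any⁺; any⁻)
  open import Data.List.Relation.Unary.Linked using (Linked; []; [-]; _∷_)
  import Data.List.Relation.Unary.Linked as Linked
  open import Data.List.Relation.Unary.Linked.Properties using () renaming (map⁺ to Linked-map⁺)
  open import Data.Nat using (ℕ; zero; suc; _+_; _*_; _^_; _∸_; _<_; _≤_; s≤s; z≤n; _<ᵇ_; _≡ᵇ_)
  open import Data.Nat.Combinatorics using (_C_; nCk+nC[k+1]≡[n+1]C[k+1]; k>n⇒nCk≡0)
  open import Data.Nat.DivMod using (/-monoˡ-≤; m*n/n≡m)
  open import Data.Nat.ListAction using (sum)
  open import Data.Nat.ListAction.Properties using (sum-↭)
  open import Data.Nat.Properties
    using (<⇒<ᵇ; <ᵇ⇒<; ≡ᵇ⇒≡; ≡⇒≡ᵇ; _≤?_; module ≤-Reasoning;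
           <⇒≱; <⇒≤; <-trans; <-≤-trans; <⇒≢; >⇒≢; ≤-trans; ≤-refl; ≤-reflexive; ≤-pred; ≰⇒>;
           n<1+n; n≤1+n; m<n⇒m<1+n; m≤n⇒m≤o+n; m≤n+m; m≤m+n; m<m+n; suc-injective; m+n≡0⇒m≡0; m+n≡0⇒n≡0;
           +-suc; +-assoc; +-comm; +-identityʳ; +-monoʳ-≤; +-mono-≤; +-cancelʳ-≡;
           *-zeroʳ; *-identityˡ; *-identityʳ; *-assoc; *-distribˡ-+; *-distribʳ-+)
  open import Data.Nat.Tactic.RingSolver using (solve-∀)
  open import Data.Product using (_×_; _,_; ∃)
  open import Data.Sum using (inj₁; inj₂)
  open import Data.Vec using ([]; _∷_)
  open import Data.Vec.Base using (_[_]=_)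
  open import Data.Vec.Properties using (≡-dec)
  open import Function using (_∘_)
  open import Relation.Binary.PropositionalEquality
  open import Relation.Nullary using (yes; no; does)

  insertions-↭ : ∀ {A : Set} (x : A) zs {ys} → ys ∈ insertions x zs → ys ↭ x ∷ zs
  insertions-↭ x []       (here refl) = ↭-refl
  insertions-↭ x (z ∷ zs) (here refl) = ↭-refl
  insertions-↭ x (z ∷ zs) (there ys∈) with ∈-map⁻ (z ∷_) ys∈
  ... | ws , ws∈ , refl = ↭-trans (prep z (insertions-↭ x zs ws∈)) (swap z x ↭-refl)

  ∈-insertions : ∀ {A : Set} (x : A) l r → l ++ x ∷ r ∈ insertions x (l ++ r)
  ∈-insertions x []      []      = here refl
  ∈-insertions x []      (y ∷ r) = here refl
  ∈-insertions x (z ∷ l) r       = there (∈-map⁺ (z ∷_) (∈-insertions x l r))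

  orderings-↭ : ∀ {A : Set} (xs : List A) {σ} → σ ∈ orderings xs → σ ↭ xs
  orderings-↭ []       (here refl) = ↭-refl
  orderings-↭ (x ∷ xs) σ∈ with find (∈-concatMap⁻ (insertions x) {xs = orderings xs} σ∈)
  ... | τ , τ∈ , σ∈ins = ↭-trans (insertions-↭ x τ σ∈ins) (prep x (orderings-↭ xs τ∈))

  ↭-orderings : ∀ {A : Set} (xs : List A) {σ} → σ ↭ xs → σ ∈ orderings xs
  ↭-orderings []       σ↭ rewrite ↭-empty-inv σ↭ = here refl
  ↭-orderings (x ∷ xs) σ↭ with ∈-∃++ (∈-resp-↭ (↭-sym σ↭) (here refl))
  ... | l , r , refl =
    ∈-concatMap⁺ (insertions x) (lose (↭-orderings xs (drop-mid l [] σ↭)) (∈-insertions x l r))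

  <ᵇ-true : ∀ {x y} → x < y → (x <ᵇ y) ≡ true
  <ᵇ-true {x} {y} x<y with x <ᵇ y in eq
  ... | true  = refl
  ... | false = ⊥-elim (subst T eq (<⇒<ᵇ x<y))

  <ᵇ-false : ∀ {x y} → y ≤ x → (x <ᵇ y) ≡ false
  <ᵇ-false {x} {y} y≤x with x <ᵇ y in eq
  ... | true  = ⊥-elim (<⇒≱ (<ᵇ⇒< x y (subst T (sym eq) _)) y≤x)
  ... | false = refl

  peaks : List ℕ → List ℕ
  peaks (a ∷ b ∷ c ∷ r) = (if (a <ᵇ b) ∧ (c <ᵇ b) then b ∷ [] else []) ++ peaks (b ∷ c ∷ r)
  peaks _               = []

  peakValues-toℕ : ∀ {n} (σ : List (Fin n)) → map toℕ (peakValues σ) ≡ peaks (map toℕ σ)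
  peakValues-toℕ []              = refl
  peakValues-toℕ (a ∷ [])        = refl
  peakValues-toℕ (a ∷ b ∷ [])    = refl
  peakValues-toℕ (a ∷ b ∷ c ∷ r) =
    trans (map-++ toℕ (if (a <F b) ∧ (c <F b) then b ∷ [] else []) _)
          (cong₂ _++_ (map-if ((a <F b) ∧ (c <F b))) (peakValues-toℕ (b ∷ c ∷ r)))
    where
    map-if : ∀ x → map toℕ (if x then b ∷ [] else []) ≡ (if x then toℕ b ∷ [] else [])
    map-if true  = refl
    map-if false = refl

  peaks-peak : ∀ {a b c} r → a < b → c < b → peaks (a ∷ b ∷ c ∷ r) ≡ b ∷ peaks (b ∷ c ∷ r)
  peaks-peak {a} {b} {c} r a<b c<b rewrite <ᵇ-true a<b | <ᵇ-true c<b = refl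

  peaks-nonpeak : ∀ a b c r → (a <ᵇ b) ∧ (c <ᵇ b) ≡ false → peaks (a ∷ b ∷ c ∷ r) ≡ peaks (b ∷ c ∷ r)
  peaks-nonpeak a b c r eq rewrite eq = refl

  peaks-descent : ∀ {s x} xs → x < s → peaks (s ∷ x ∷ xs) ≡ peaks (x ∷ xs)
  peaks-descent         []      x<s = refl
  peaks-descent {s} {x} (c ∷ r) x<s = peaks-nonpeak s x c r (cong (_∧ (c <ᵇ x)) (<ᵇ-false (<⇒≤ x<s)))

  peaks-ascending : ∀ {us} → Linked _<_ us → peaks us ≡ []
  peaks-ascending []                              = refl
  peaks-ascending [-]                             = refl
  peaks-ascending (_ ∷ [-])                       = refl
  peaks-ascending {a ∷ b ∷ c ∷ r} (a<b ∷ b<c ∷ h) =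
    trans (peaks-nonpeak a b c r (trans (cong ((a <ᵇ b) ∧_) (<ᵇ-false (<⇒≤ b<c))) (∧-zeroʳ _)))
          (peaks-ascending (b<c ∷ h))

  interleave : {A : Set} → List A → List A → List A
  interleave []       ps = ps
  interleave (u ∷ us) ps = u ∷ interleave ps us

  -- `Alternating e us ps`: the valleys us, preceded by e imaginary valleys below every entry, can
  -- be interleaved with the peaks ps (both ascending) so that exactly the ps are peaks.
  Alternating : ℕ → List ℕ → List ℕ → Set
  Alternating e             us            []       = Linked _<_ us
  Alternating (suc (suc e)) us            (p ∷ ps) = Alternating (suc e) us ps
  Alternating (suc zero)    (u ∷ us)      (p ∷ ps) = u < p × Alternating zero (u ∷ us) ps
  Alternating zero          (u ∷ u′ ∷ us) (p ∷ ps) = u < u′ × u′ < p × Alternating zero (u′ ∷ us) ps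
  Alternating _             _             _        = ⊥

  ascending-map-suc : ∀ {us} → Linked _<_ us → Linked _<_ (map suc us)
  ascending-map-suc h = Linked-map⁺ (Linked.map s≤s h)

  alternating-map-suc : ∀ e us ps → Alternating e us ps → Alternating e (map suc us) (map suc ps)
  alternating-map-suc e             us            []       h                = ascending-map-suc h
  alternating-map-suc (suc (suc e)) us            (p ∷ ps) h                = alternating-map-suc (suc e) us ps h
  alternating-map-suc (suc zero)    (u ∷ us)      (p ∷ ps) (u<p , h)        = s≤s u<p , alternating-map-suc zero (u ∷ us) ps h
  alternating-map-suc zero          (u ∷ u′ ∷ us) (p ∷ ps) (u<u′ , u′<p , h) =
    s≤s u<u′ , s≤s u′<p , alternating-map-suc zero (u′ ∷ us) ps h

  alternating-∷-zero : ∀ e us ps → Alternating (suc e) us ps → Alternating e (0 ∷ map suc us) (map suc ps)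
  alternating-∷-zero e             []       []       h         = [-]
  alternating-∷-zero e             (u ∷ us) []       h         = s≤s z≤n ∷ ascending-map-suc h
  alternating-∷-zero (suc (suc e)) us       (p ∷ ps) h         = alternating-∷-zero (suc e) us ps h
  alternating-∷-zero (suc zero)    us       (p ∷ ps) h         = s≤s z≤n , alternating-∷-zero zero us ps h
  alternating-∷-zero zero          (u ∷ us) (p ∷ ps) (u<p , h) = s≤s z≤n , s≤s u<p , alternating-map-suc zero (u ∷ us) ps h

  peaks-interleave : ∀ us ps → Alternating zero us ps → peaks (interleave us ps) ≡ ps
  peaks-interleave []            []       h                   = refl
  peaks-interleave (u ∷ us)      []       h                   = peaks-ascending h
  peaks-interleave (u ∷ u′ ∷ us) (p ∷ ps) (u<u′ , u′<p , h) = begin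
    peaks (u ∷ p ∷ u′ ∷ interleave ps us)  ≡⟨ peaks-peak (interleave ps us) (<-trans u<u′ u′<p) u′<p ⟩
    p ∷ peaks (p ∷ u′ ∷ interleave ps us)  ≡⟨ cong (p ∷_) (peaks-descent (interleave ps us) u′<p) ⟩
    p ∷ peaks (u′ ∷ interleave ps us)      ≡⟨ cong (p ∷_) (peaks-interleave (u′ ∷ us) ps h) ⟩
    p ∷ ps                                 ∎
    where open ≡-Reasoning

  -- Admissible sets are circular peak sets

  -- Reading [n] upwards, the slack e grows by one at each non-member and drops by one at each
  -- member, which needs slack at least 2.  For e = 0 this says that the j-th smallest member
  -- is at least 2j + 1 (values counted from 1).
  admissible : ∀ {n} → ℕ → Subset n → Bool
  admissible e             []          = true
  admissible e             (false ∷ S) = admissible (suc e) S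
  admissible zero          (true ∷ S)  = false
  admissible (suc zero)    (true ∷ S)  = false
  admissible (suc (suc e)) (true ∷ S)  = admissible (suc e) S

  members nonMembers : ∀ {n} → Subset n → List (Fin n)
  members []          = []
  members (true ∷ S)  = fzero ∷ map fsuc (members S)
  members (false ∷ S) = map fsuc (members S)
  nonMembers []          = []
  nonMembers (true ∷ S)  = map fsuc (nonMembers S)
  nonMembers (false ∷ S) = fzero ∷ map fsuc (nonMembers S)

  toℕ-fsuc : ∀ {n} (L : List (Fin n)) → map toℕ (map fsuc L) ≡ map suc (map toℕ L)
  toℕ-fsuc L = trans (sym (map-∘ L)) (map-∘ L)

  alternating-admissible : ∀ {n} e (S : Subset n) → admissible e S ≡ true →
                           Alternating e (map toℕ (nonMembers S)) (map toℕ (members S))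
  alternating-admissible e [] h = []
  alternating-admissible e (false ∷ S) h
    rewrite toℕ-fsuc (nonMembers S) | toℕ-fsuc (members S) =
    alternating-∷-zero e (map toℕ (nonMembers S)) (map toℕ (members S)) (alternating-admissible (suc e) S h)
  alternating-admissible (suc (suc e)) (true ∷ S) h
    rewrite toℕ-fsuc (nonMembers S) | toℕ-fsuc (members S) =
    alternating-map-suc (suc e) (map toℕ (nonMembers S)) (map toℕ (members S)) (alternating-admissible (suc e) S h)

  map-interleave : {A B : Set} (f : A → B) (us ps : List A) →
                   map f (interleave us ps) ≡ interleave (map f us) (map f ps)
  map-interleave f []       ps = refl
  map-interleave f (u ∷ us) ps = cong (f u ∷_) (map-interleave f ps us)

  peakPermutation : ∀ {n} → Subset n → List (Fin n)
  peakPermutation S = interleave (nonMembers S) (members S)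

  peakValues-peakPermutation : ∀ {n} (S : Subset n) → admissible 0 S ≡ true →
                               peakValues (peakPermutation S) ≡ members S
  peakValues-peakPermutation S h = map-injective toℕ-injective (begin
    map toℕ (peakValues (peakPermutation S))                        ≡⟨ peakValues-toℕ (peakPermutation S) ⟩
    peaks (map toℕ (peakPermutation S))                             ≡⟨ cong peaks (map-interleave toℕ (nonMembers S) (members S)) ⟩
    peaks (interleave (map toℕ (nonMembers S)) (map toℕ (members S))) ≡⟨ peaks-interleave _ _ (alternating-admissible 0 S h) ⟩
    map toℕ (members S)                                             ∎)
    where open ≡-Reasoning

  fromList : ∀ {n} → List (Fin n) → Subset n
  fromList = foldr (λ v S → ⁅ v ⁆ ∪ S) ∅

  fromList-fsuc : ∀ {n} (L : List (Fin n)) → fromList (map fsuc L) ≡ false ∷ fromList L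
  fromList-fsuc []      = refl
  fromList-fsuc (x ∷ L) rewrite fromList-fsuc L = refl

  fromList-members : ∀ {n} (S : Subset n) → fromList (members S) ≡ S
  fromList-members []          = refl
  fromList-members (true ∷ S)  rewrite fromList-fsuc (members S) | fromList-members S = cong (true ∷_) (∪-identityˡ S)
  fromList-members (false ∷ S) rewrite fromList-fsuc (members S) | fromList-members S = refl

  CP-peakPermutation : ∀ {n} (S : Subset n) → admissible 0 S ≡ true → CP (peakPermutation S) ≡ S
  CP-peakPermutation S h = trans (cong fromList (peakValues-peakPermutation S h)) (fromList-members S)

  interleave-↭ : {A : Set} (us ps : List A) → interleave us ps ↭ us ++ ps
  interleave-↭ []       ps = ↭-refl
  interleave-↭ (u ∷ us) ps = prep u (↭-trans (interleave-↭ ps us) (++-comm ps us))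

  allFin-suc : ∀ n → allFin (suc n) ≡ fzero ∷ map fsuc (allFin n)
  allFin-suc n = cong (fzero ∷_) (sym (map-tabulate (λ i → i) fsuc))

  nonMembers++members-↭ : ∀ {n} (S : Subset n) → nonMembers S ++ members S ↭ allFin n
  shifted-↭ : ∀ {n} (S : Subset n) → map fsuc (nonMembers S) ++ map fsuc (members S) ↭ map fsuc (allFin n)
  nonMembers++members-↭ []                = ↭-refl
  nonMembers++members-↭ {suc n} (true ∷ S) rewrite allFin-suc n =
    ↭-trans (shift fzero (map fsuc (nonMembers S)) (map fsuc (members S))) (prep fzero (shifted-↭ S))
  nonMembers++members-↭ {suc n} (false ∷ S) rewrite allFin-suc n = prep fzero (shifted-↭ S)
  shifted-↭ S = ↭-trans (↭-reflexive (sym (map-++ fsuc (nonMembers S) (members S)))) (↭-map⁺ fsuc (nonMembers++members-↭ S))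

  peakPermutation-↭ : ∀ {n} (S : Subset n) → peakPermutation S ↭ allFin n
  peakPermutation-↭ S = ↭-trans (interleave-↭ (nonMembers S) (members S)) (nonMembers++members-↭ S)

  -- Circular peak sets are admissible

  bool→ℕ : Bool → ℕ
  bool→ℕ true  = 1
  bool→ℕ false = 0

  count : (ℕ → Bool) → List ℕ → ℕ
  count p xs = sum (map (λ x → bool→ℕ (p x)) xs)

  count-↭ : ∀ p {xs ys} → xs ↭ ys → count p xs ≡ count p ys
  count-↭ p xs↭ys = sum-↭ (↭-map⁺ _ xs↭ys)

  <ᵇ-mono : ∀ x t → bool→ℕ (x <ᵇ t) ≤ bool→ℕ (x <ᵇ suc t)
  <ᵇ-mono x t with x <ᵇ t in eq
  ... | false = z≤n
  ... | true  rewrite <ᵇ-true (m<n⇒m<1+n (<ᵇ⇒< x t (subst T (sym eq) _))) = ≤-refl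

  count-<-mono : ∀ t P → count (_<ᵇ t) P ≤ count (_<ᵇ suc t) P
  count-<-mono t []      = z≤n
  count-<-mono t (x ∷ P) = +-mono-≤ (<ᵇ-mono x t) (count-<-mono t P)

  count-<-∈ : ∀ {t} P → t ∈ P → suc (count (_<ᵇ t) P) ≤ count (_<ᵇ suc t) P
  count-<-∈ {t} (x ∷ P) (here refl) rewrite <ᵇ-false (≤-refl {t}) | <ᵇ-true (n<1+n t) = s≤s (count-<-mono t P)
  count-<-∈ {t} (x ∷ P) (there t∈)  =
    subst (_≤ count (_<ᵇ suc t) (x ∷ P)) (+-suc (bool→ℕ (x <ᵇ t)) _) (+-mono-≤ (<ᵇ-mono x t) (count-<-∈ P t∈))

  count-allFin : ∀ n t → t ≤ n → count (_<ᵇ t) (map toℕ (allFin n)) ≡ t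
  count-allFin n       zero    _         = count-zero (map toℕ (allFin n))
    where
    count-zero : ∀ xs → count (_<ᵇ 0) xs ≡ 0
    count-zero []       = refl
    count-zero (x ∷ xs) = count-zero xs
  count-allFin (suc n) (suc t) (s≤s t≤n) = begin
    count (_<ᵇ suc t) (map toℕ (allFin (suc n)))           ≡⟨ cong (count (_<ᵇ suc t) ∘ map toℕ) (allFin-suc n) ⟩
    suc (count (_<ᵇ suc t) (map toℕ (map fsuc (allFin n)))) ≡⟨ cong (suc ∘ count (_<ᵇ suc t)) (toℕ-fsuc (allFin n)) ⟩
    suc (count (_<ᵇ suc t) (map suc (map toℕ (allFin n))))  ≡⟨ cong suc (count-map-suc (map toℕ (allFin n))) ⟩
    suc (count (_<ᵇ t) (map toℕ (allFin n)))                ≡⟨ cong suc (count-allFin n t t≤n) ⟩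
    suc t                                                   ∎
    where
    open ≡-Reasoning
    count-map-suc : ∀ xs → count (_<ᵇ suc t) (map suc xs) ≡ count (_<ᵇ t) xs
    count-map-suc []       = refl
    count-map-suc (x ∷ xs) = cong (bool→ℕ (x <ᵇ t) +_) (count-map-suc xs)

  -- Besides the K peaks below t, the entries below t include a smaller neighbour of each of the
  -- M peaks up to t, and one more neighbour as soon as there is such a peak or the list starts
  -- below t.
  record Bound (K M A : ℕ) (H : Set) : Set where
    field
      bound     : K + M ≤ A
      boundIfPeak : 1 ≤ M → suc (K + M) ≤ A
      boundIfHead : H → suc (K + M) ≤ A
  open Bound

  HeadBelow : ℕ → List ℕ → Set
  HeadBelow t []      = ⊥
  HeadBelow t (x ∷ _) = x < t

  PeakBound : ℕ → List ℕ → Set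
  PeakBound t σ = Bound (count (_<ᵇ t) (peaks σ)) (count (_<ᵇ suc t) (peaks σ)) (count (_<ᵇ t) σ) (HeadBelow t σ)

  Bound-∷ : ∀ {t x K M A H} → Bound K M A H → Bound K M (bool→ℕ (x <ᵇ t) + A) (x < t)
  Bound-∷ {t} {x} {K} {M} {A} b = record
    { bound     = m≤n⇒m≤o+n (bool→ℕ (x <ᵇ t)) (bound b)
    ; boundIfPeak = λ 1≤M → m≤n⇒m≤o+n (bool→ℕ (x <ᵇ t)) (boundIfPeak b 1≤M)
    ; boundIfHead = λ x<t → subst (λ c → suc (K + M) ≤ bool→ℕ c + A) (sym (<ᵇ-true x<t)) (s≤s (bound b))
    }

  Bound-peak : ∀ {β K M A H} → suc (K + M) ≤ A → Bound (β + K) (suc M) (suc (β + A)) H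
  Bound-peak {β} {K} {M} {A} h = record { bound = ≤-trans (n≤1+n _) step ; boundIfPeak = λ _ → step ; boundIfHead = λ _ → step }
    where
    open ≤-Reasoning
    step : suc ((β + K) + suc M) ≤ suc (β + A)
    step = begin
      suc ((β + K) + suc M)     ≡⟨ cong suc (+-suc (β + K) M) ⟩
      suc (suc ((β + K) + M))   ≡⟨ cong (suc ∘ suc) (+-assoc β K M) ⟩
      suc (suc (β + (K + M)))   ≡⟨ cong suc (+-suc β (K + M)) ⟨
      suc (β + suc (K + M))     ≤⟨ s≤s (+-monoʳ-≤ β h) ⟩
      suc (β + A)               ∎

  ∧-true : ∀ {p q} → p ∧ q ≡ true → p ≡ true × q ≡ true
  ∧-true {true} {true} _ = refl , refl

  <ᵇ⇒<′ : ∀ {x y} → (x <ᵇ y) ≡ true → x < y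
  <ᵇ⇒<′ {x} {y} eq = <ᵇ⇒< x y (subst T (sym eq) _)

  Bound-∷-peak : ∀ {t a b c K M A} → a < b → c < b → Bound K M A (c < t) →
                    Bound (bool→ℕ (b <ᵇ t) + K) (bool→ℕ (b <ᵇ suc t) + M)
                          (bool→ℕ (a <ᵇ t) + (bool→ℕ (b <ᵇ t) + A)) (a < t)
  Bound-∷-peak {t} {b = b} a<b c<b h with b ≤? t
  ... | yes b≤t rewrite <ᵇ-true (<-≤-trans a<b b≤t) | <ᵇ-true (s≤s b≤t) = Bound-peak (boundIfHead h (<-≤-trans c<b b≤t))
  ... | no b≰t  rewrite <ᵇ-false (<⇒≤ (≰⇒> b≰t)) | <ᵇ-false (≰⇒> b≰t) = Bound-∷ h

  peakBound-step : ∀ {t} a b c r → PeakBound t (b ∷ c ∷ r) → PeakBound t (c ∷ r) → PeakBound t (a ∷ b ∷ c ∷ r)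
  peakBound-step {t} a b c r ih₁ ih₂ with (a <ᵇ b) ∧ (c <ᵇ b) in eq
  ... | false = Bound-∷ ih₁
  ... | true with ∧-true eq
  ...   | ab , cb =
    subst (λ P → Bound (count (_<ᵇ t) (b ∷ P)) (count (_<ᵇ suc t) (b ∷ P)) (count (_<ᵇ t) (a ∷ b ∷ c ∷ r)) (a < t))
          (sym (peaks-descent r (<ᵇ⇒<′ cb)))
          (Bound-∷-peak (<ᵇ⇒<′ ab) (<ᵇ⇒<′ cb) ih₂)

  peakBound : ∀ t σ → PeakBound t σ
  peakBound t []              = record { bound = z≤n ; boundIfPeak = λ () ; boundIfHead = λ () }
  peakBound t (a ∷ [])        = Bound-∷ (peakBound t [])
  peakBound t (a ∷ b ∷ [])    = Bound-∷ (peakBound t (b ∷ []))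
  peakBound t (a ∷ b ∷ c ∷ r) = peakBound-step a b c r (peakBound t (b ∷ c ∷ r)) (peakBound t (c ∷ r))

  peak-lowerBound : ∀ σ {t} → t ∈ peaks σ →
                    suc (suc (count (_<ᵇ t) (peaks σ) + count (_<ᵇ t) (peaks σ))) ≤ count (_<ᵇ t) σ
  peak-lowerBound σ {t} t∈ = begin
    suc (suc (K + K)) ≡⟨ cong suc (+-suc K K) ⟨
    suc (K + suc K)   ≤⟨ s≤s (+-monoʳ-≤ K K<M) ⟩
    suc (K + M)       ≤⟨ boundIfPeak (peakBound t σ) (≤-trans (s≤s z≤n) K<M) ⟩
    count (_<ᵇ t) σ   ∎
    where
    open ≤-Reasoning
    K = count (_<ᵇ t) (peaks σ)
    M = count (_<ᵇ suc t) (peaks σ)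
    K<M : suc K ≤ M
    K<M = count-<-∈ (peaks σ) t∈

  membersBelow : ∀ {n} → Subset n → ℕ → ℕ
  membersBelow []      t       = 0
  membersBelow (b ∷ S) zero    = 0
  membersBelow (b ∷ S) (suc t) = bool→ℕ b + membersBelow S t

  membersBelow-∅ : ∀ n t → membersBelow (∅ {n}) t ≡ 0
  membersBelow-∅ zero    t       = refl
  membersBelow-∅ (suc n) zero    = refl
  membersBelow-∅ (suc n) (suc t) = membersBelow-∅ n t

  membersBelow-⁅⁆∪ : ∀ {n} (v : Fin n) X t → membersBelow (⁅ v ⁆ ∪ X) t ≤ bool→ℕ (toℕ v <ᵇ t) + membersBelow X t
  membersBelow-⁅⁆∪ fzero    (b ∷ X) zero    = z≤n
  membersBelow-⁅⁆∪ (fsuc v) (b ∷ X) zero    = z≤n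
  membersBelow-⁅⁆∪ fzero    (b ∷ X) (suc t) rewrite ∪-identityˡ X = s≤s (m≤n+m _ (bool→ℕ b))
  membersBelow-⁅⁆∪ (fsuc v) (b ∷ X) (suc t) =
    ≤-trans (+-monoʳ-≤ (bool→ℕ b) (membersBelow-⁅⁆∪ v X t))
            (≤-reflexive (swap-front (bool→ℕ b) (bool→ℕ (toℕ v <ᵇ t)) (membersBelow X t)))
    where
    swap-front : ∀ a b c → a + (b + c) ≡ b + (a + c)
    swap-front = solve-∀

  membersBelow-fromList : ∀ {n} (L : List (Fin n)) t → membersBelow (fromList L) t ≤ count (_<ᵇ t) (map toℕ L)
  membersBelow-fromList {n} []    t = ≤-reflexive (membersBelow-∅ n t)
  membersBelow-fromList (v ∷ L) t =
    ≤-trans (membersBelow-⁅⁆∪ v (fromList L) t) (+-monoʳ-≤ (bool→ℕ (toℕ v <ᵇ t)) (membersBelow-fromList L t))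

  ∈-fromList⁻ : ∀ {n} (L : List (Fin n)) {v} → v ∈ₛ fromList L → v ∈ L
  ∈-fromList⁻ []      v∈ = ⊥-elim (∉⊥ v∈)
  ∈-fromList⁻ (w ∷ L) v∈ with x∈p∪q⁻ ⁅ w ⁆ (fromList L) v∈
  ... | inj₁ v∈⁅w⁆ = here (x∈⁅y⁆⇒x≡y w v∈⁅w⁆)
  ... | inj₂ v∈L   = there (∈-fromList⁻ L v∈L)

  admissible-if : ∀ {n} e (S : Subset n) →
                  (∀ v → v ∈ₛ S → suc (suc (membersBelow S (toℕ v) + membersBelow S (toℕ v))) ≤ e + toℕ v) →
                  admissible e S ≡ true
  admissible-if e []          h = refl
  admissible-if e (false ∷ S) h =
    admissible-if (suc e) S λ v v∈ →
      subst (suc (suc (membersBelow S (toℕ v) + membersBelow S (toℕ v))) ≤_) (+-suc e (toℕ v)) (h (fsuc v) (_[_]=_.there v∈))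
  admissible-if zero          (true ∷ S) h with () ← h fzero _[_]=_.here
  admissible-if (suc zero)    (true ∷ S) h with s≤s () ← h fzero _[_]=_.here
  admissible-if (suc (suc e)) (true ∷ S) h =
    admissible-if (suc e) S (λ v v∈ → shift-down (membersBelow S (toℕ v)) (toℕ v) (h (fsuc v) (_[_]=_.there v∈)))
    where
    shift-down : ∀ c t → suc (suc (suc c + suc c)) ≤ suc (suc e) + suc t → suc (suc (c + c)) ≤ suc e + t
    shift-down c t h rewrite +-suc c c | +-suc (suc e) t = ≤-pred (≤-pred h)

  admissible-CP : ∀ {n} (σ : List (Fin n)) → σ ↭ allFin n → admissible 0 (CP σ) ≡ true
  admissible-CP {n} σ σ↭ = admissible-if 0 (CP σ) λ v v∈ → begin
      suc (suc (membersBelow (CP σ) (toℕ v) + membersBelow (CP σ) (toℕ v)))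
    ≤⟨ s≤s (s≤s (+-mono-≤ (below v) (below v))) ⟩
      suc (suc (count (_<ᵇ toℕ v) P + count (_<ᵇ toℕ v) P))
    ≤⟨ peak-lowerBound (map toℕ σ) (subst (toℕ v ∈_) (peakValues-toℕ σ) (∈-map⁺ toℕ (∈-fromList⁻ _ v∈))) ⟩
      count (_<ᵇ toℕ v) (map toℕ σ)
    ≡⟨ count-↭ (_<ᵇ toℕ v) (↭-map⁺ toℕ σ↭) ⟩
      count (_<ᵇ toℕ v) (map toℕ (allFin n))
    ≡⟨ count-allFin n (toℕ v) (<⇒≤ (toℕ<n v)) ⟩
      toℕ v
    ∎
    where
    open ≤-Reasoning
    P = peaks (map toℕ σ)
    below : ∀ v → membersBelow (CP σ) (toℕ v) ≤ count (_<ᵇ toℕ v) P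
    below v = subst (λ Q → membersBelow (CP σ) (toℕ v) ≤ count (_<ᵇ toℕ v) Q) (peakValues-toℕ σ)
                    (membersBelow-fromList (peakValues σ) (toℕ v))

  T→≡true : ∀ {b} → T b → b ≡ true
  T→≡true {true} _ = refl

  ¬T→≡false : ∀ {b} → (T b → ⊥) → b ≡ false
  ¬T→≡false {true}  ¬t = ⊥-elim (¬t _)
  ¬T→≡false {false} _  = refl

  ≟S-sound : ∀ {n} {S R : Subset n} → T (S ≟S R) → S ≡ R
  ≟S-sound {S = S} {R} t with ≡-dec Bool._≟_ S R
  ... | yes S≡R = S≡R

  ≟S-complete : ∀ {n} {S R : Subset n} → S ≡ R → T (S ≟S R)
  ≟S-complete {S = S} {R} S≡R with ≡-dec Bool._≟_ S R
  ... | yes _   = _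
  ... | no S≢R = S≢R S≡R

  ∈-Sym⁺ : ∀ {n} {σ : List (Fin n)} → σ ↭ allFin n → σ ∈ Sym n
  ∈-Sym⁺ = ↭-orderings (allFin _)

  ∈-Sym⁻ : ∀ {n} {σ : List (Fin n)} → σ ∈ Sym n → σ ↭ allFin n
  ∈-Sym⁻ = orderings-↭ (allFin _)

  isCP≡admissible : ∀ {n} (S : Subset n) → any (λ σ → CP σ ≟S S) (Sym n) ≡ admissible 0 S
  isCP≡admissible {n} S with admissible 0 S in adm
  ... | true  = T→≡true (any⁺ isCP (lose (∈-Sym⁺ (peakPermutation-↭ S)) (≟S-complete (CP-peakPermutation S adm))))
    where isCP = λ σ → CP σ ≟S S
  ... | false = ¬T→≡false λ T-any → not-CP (find (any⁻ (λ σ → CP σ ≟S S) (Sym n) T-any))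
    where
    not-CP : ∃ (λ σ → σ ∈ Sym n × T (CP σ ≟S S)) → ⊥
    not-CP (σ , σ∈ , CPσ≟S) with () ←
      trans (sym adm) (subst (λ R → admissible 0 R ≡ true) (≟S-sound {S = CP σ} {S} CPσ≟S) (admissible-CP σ (∈-Sym⁻ σ∈)))

  filterᵇ-cong : {A : Set} {p q : A → Bool} → (∀ x → p x ≡ q x) → ∀ xs → filterᵇ p xs ≡ filterᵇ q xs
  filterᵇ-cong         p≗q []       = refl
  filterᵇ-cong {q = q} p≗q (x ∷ xs) rewrite p≗q x with q x
  ... | true  = cong (x ∷_) (filterᵇ-cong p≗q xs)
  ... | false = filterᵇ-cong p≗q xs

  Admissible : ∀ n → List (Subset n)
  Admissible n = filterᵇ (admissible 0) (allSubsets n)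

  𝒫≡Admissible : ∀ n → 𝒫 n ≡ Admissible n
  𝒫≡Admissible n = filterᵇ-cong isCP≡admissible (allSubsets n)

  ∑ : {A : Set} → List A → (A → ℕ) → ℕ
  ∑ []      f = 0
  ∑ (x ∷ L) f = f x + ∑ L f

  syntax ∑ L (λ x → e) = ∑[ x ∈ L ] e

  ∑-cong : {A : Set} {f g : A → ℕ} (L : List A) → (∀ x → f x ≡ g x) → ∑ L f ≡ ∑ L g
  ∑-cong []      f≗g = refl
  ∑-cong (x ∷ L) f≗g = cong₂ _+_ (f≗g x) (∑-cong L f≗g)

  ∑-zero : {A : Set} (L : List A) → ∑[ x ∈ L ] 0 ≡ 0
  ∑-zero []      = refl
  ∑-zero (x ∷ L) = ∑-zero L

  ∑-*-zero : {A : Set} (L : List A) (c : A → ℕ) → ∑[ x ∈ L ] (c x * 0) ≡ 0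
  ∑-*-zero []      c = refl
  ∑-*-zero (x ∷ L) c = trans (cong (_+ ∑[ y ∈ L ] (c y * 0)) (*-zeroʳ (c x))) (∑-*-zero L c)

  ∑-+ : {A : Set} (L : List A) (f g : A → ℕ) → ∑[ x ∈ L ] (f x + g x) ≡ ∑ L f + ∑ L g
  ∑-+ []      f g = refl
  ∑-+ (x ∷ L) f g = trans (cong (f x + g x +_) (∑-+ L f g)) (regroup (f x) (g x) (∑ L f) (∑ L g))
    where
    regroup : ∀ a b c d → a + b + (c + d) ≡ a + c + (b + d)
    regroup = solve-∀

  ∑-* : {A : Set} (L : List A) (k : ℕ) (f : A → ℕ) → ∑[ x ∈ L ] (k * f x) ≡ k * ∑ L f
  ∑-* []      k f = sym (*-zeroʳ k)
  ∑-* (x ∷ L) k f = trans (cong (k * f x +_) (∑-* L k f)) (sym (*-distribˡ-+ k (f x) (∑ L f)))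

  ∑-++ : {A : Set} (L M : List A) (f : A → ℕ) → ∑ (L ++ M) f ≡ ∑ L f + ∑ M f
  ∑-++ []      M f = refl
  ∑-++ (x ∷ L) M f = trans (cong (f x +_) (∑-++ L M f)) (sym (+-assoc (f x) _ _))

  ∑-map : {A B : Set} (g : A → B) (L : List A) (f : B → ℕ) → ∑ (map g L) f ≡ ∑ L (f ∘ g)
  ∑-map g []      f = refl
  ∑-map g (x ∷ L) f = cong (f (g x) +_) (∑-map g L f)

  ∑-filterᵇ : {A : Set} (p : A → Bool) (L : List A) (f : A → ℕ) →
              ∑ (filterᵇ p L) f ≡ ∑[ x ∈ L ] (if p x then f x else 0)
  ∑-filterᵇ p []      f = refl
  ∑-filterᵇ p (x ∷ L) f with p x
  ... | true  = cong (f x +_) (∑-filterᵇ p L f)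
  ... | false = ∑-filterᵇ p L f

  ∑-allSubsets : ∀ n (f : Subset (suc n) → ℕ) →
                 ∑ (allSubsets (suc n)) f ≡ ∑ (allSubsets n) (f ∘ (true ∷_)) + ∑ (allSubsets n) (f ∘ (false ∷_))
  ∑-allSubsets n f = trans (∑-++ (map (true ∷_) (allSubsets n)) _ f)
                           (cong₂ _+_ (∑-map (true ∷_) (allSubsets n) f) (∑-map (false ∷_) (allSubsets n) f))

  length-filterᵇ-concatMap : {A B : Set} (p : B → Bool) (g : A → List B) (L : List A) →
                             length (filterᵇ p (concatMap g L)) ≡ ∑[ x ∈ L ] length (filterᵇ p (g x))
  length-filterᵇ-concatMap p g []      = refl
  length-filterᵇ-concatMap p g (x ∷ L) = begin
    length (filterᵇ p (g x ++ concatMap g L))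
      ≡⟨ cong length (filter-++ (T? ∘ p) (g x) (concatMap g L)) ⟩
    length (filterᵇ p (g x) ++ filterᵇ p (concatMap g L))
      ≡⟨ length-++ (filterᵇ p (g x)) ⟩
    length (filterᵇ p (g x)) + length (filterᵇ p (concatMap g L))
      ≡⟨ cong (length (filterᵇ p (g x)) +_) (length-filterᵇ-concatMap p g L) ⟩
    length (filterᵇ p (g x)) + ∑[ y ∈ L ] length (filterᵇ p (g y))
      ∎
    where open ≡-Reasoning

  -- Counting multichains

  -- extensions k e x = ∑ of k ^ ∣ S ∖ x ∣ over the S ⊇ x with admissible e S, built value by value:
  -- a value outside x either stays outside S or joins S ∖ x (weight k).
  -- extensions⁺ k e x is extensions k e (true ∷ x).
  extensions extensions⁺ : ∀ {n} → ℕ → ℕ → Subset n → ℕ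
  extensions k e []          = 1
  extensions k e (false ∷ x) = extensions k (suc e) x + k * extensions⁺ k e x
  extensions k e (true ∷ x)  = extensions⁺ k e x
  extensions⁺ k zero          x = 0
  extensions⁺ k (suc zero)    x = 0
  extensions⁺ k (suc (suc e)) x = extensions k (suc e) x

  admissible-suc : ∀ {n} e (x : Subset n) → admissible e x ≡ true → admissible (suc e) x ≡ true
  admissible-suc e             []          h = refl
  admissible-suc e             (false ∷ x) h = admissible-suc (suc e) x h
  admissible-suc (suc (suc e)) (true ∷ x)  h = admissible-suc (suc e) x h

  admissible-pred : ∀ {n} e (x : Subset n) → admissible (suc e) x ≡ false → admissible e x ≡ false
  admissible-pred e x h with admissible e x in eq
  ... | false = refl
  ... | true  = trans (sym (admissible-suc e x eq)) h

  member-inadmissible : ∀ {n} e (x : Subset n) → admissible (suc e) x ≡ false → admissible e (true ∷ x) ≡ false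
  member-inadmissible zero          x h = refl
  member-inadmissible (suc zero)    x h = refl
  member-inadmissible (suc (suc e)) x h = admissible-pred (suc e) x (admissible-pred (suc (suc e)) x h)

  extensions-inadmissible : ∀ {n} k e (x : Subset n) → admissible e x ≡ false → extensions k e x ≡ 0
  extensions⁺-inadmissible : ∀ {n} k e (x : Subset n) → admissible e (true ∷ x) ≡ false → extensions⁺ k e x ≡ 0
  extensions-inadmissible k e (false ∷ x) h = begin
    extensions k (suc e) x + k * extensions⁺ k e x
      ≡⟨ cong₂ (λ a b → a + k * b) (extensions-inadmissible k (suc e) x h)
                                   (extensions⁺-inadmissible k e x (member-inadmissible e x h)) ⟩
    k * 0
      ≡⟨ *-zeroʳ k ⟩
    0 ∎
    where open ≡-Reasoning
  extensions-inadmissible k e (true ∷ x) h = extensions⁺-inadmissible k e x h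
  extensions⁺-inadmissible k zero          x h = refl
  extensions⁺-inadmissible k (suc zero)    x h = refl
  extensions⁺-inadmissible k (suc (suc e)) x h = extensions-inadmissible k (suc e) x h

  extensions-zero : ∀ {n} e (x : Subset n) → extensions 0 e x ≡ bool→ℕ (admissible e x)
  extensions⁺-zero : ∀ {n} e (x : Subset n) → extensions⁺ 0 e x ≡ bool→ℕ (admissible e (true ∷ x))
  extensions-zero e []          = refl
  extensions-zero e (false ∷ x) = trans (+-identityʳ _) (extensions-zero (suc e) x)
  extensions-zero e (true ∷ x)  = extensions⁺-zero e x
  extensions⁺-zero zero          x = refl
  extensions⁺-zero (suc zero)    x = refl
  extensions⁺-zero (suc (suc e)) x = extensions-zero (suc e) x

  infix 4 _⊆ᵇ_
  _⊆ᵇ_ : ∀ {n} → Subset n → Subset n → ℕ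
  x ⊆ᵇ y = bool→ℕ (does (x ⊆? y))

  -- The values of S ∖ x are split between y ∖ x and S ∖ y, which is the binomial expansion of
  -- (1 + k) ^ ∣ S ∖ x ∣.
  extensions-suc : ∀ {n} k e (x : Subset n) →
                   ∑[ y ∈ allSubsets n ] ((x ⊆ᵇ y) * extensions k e y) ≡ extensions (suc k) e x
  extensions⁺-suc : ∀ {n} k e (x : Subset n) →
                    ∑[ y ∈ allSubsets n ] ((x ⊆ᵇ y) * extensions⁺ k e y) ≡ extensions⁺ (suc k) e x
  extensions-suc k e [] = refl
  extensions-suc {suc n} k e (true ∷ x) = begin
    ∑ (allSubsets (suc n)) (λ y → (true ∷ x ⊆ᵇ y) * extensions k e y)
      ≡⟨ ∑-allSubsets n _ ⟩
    ∑[ y ∈ allSubsets n ] ((x ⊆ᵇ y) * extensions⁺ k e y) + ∑[ y ∈ allSubsets n ] 0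
      ≡⟨ cong₂ _+_ (extensions⁺-suc k e x) (∑-zero (allSubsets n)) ⟩
    extensions⁺ (suc k) e x + 0
      ≡⟨ +-identityʳ _ ⟩
    extensions⁺ (suc k) e x
      ∎
    where open ≡-Reasoning
  extensions-suc {suc n} k e (false ∷ x) = begin
    ∑ (allSubsets (suc n)) (λ y → (false ∷ x ⊆ᵇ y) * extensions k e y)
      ≡⟨ ∑-allSubsets n _ ⟩
    ∑ Y inside + ∑[ y ∈ Y ] ((x ⊆ᵇ y) * (extensions k (suc e) y + k * extensions⁺ k e y))
      ≡⟨ cong (∑ Y inside +_) (trans (∑-cong Y λ y → distrib (x ⊆ᵇ y) _ k _) (∑-+ Y outside (λ y → k * inside y))) ⟩
    ∑ Y inside + (∑ Y outside + ∑[ y ∈ Y ] (k * inside y))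
      ≡⟨ cong (λ s → ∑ Y inside + (∑ Y outside + s)) (∑-* Y k inside) ⟩
    ∑ Y inside + (∑ Y outside + k * ∑ Y inside)
      ≡⟨ cong₂ (λ a b → a + (b + k * a)) (extensions⁺-suc k e x) (extensions-suc k (suc e) x) ⟩
    extensions⁺ (suc k) e x + (extensions (suc k) (suc e) x + k * extensions⁺ (suc k) e x)
      ≡⟨ regroup (extensions⁺ (suc k) e x) (extensions (suc k) (suc e) x) k ⟩
    extensions (suc k) (suc e) x + suc k * extensions⁺ (suc k) e x
      ∎
    where
    open ≡-Reasoning
    Y = allSubsets n
    inside outside : Subset n → ℕ
    inside  y = (x ⊆ᵇ y) * extensions⁺ k e y
    outside y = (x ⊆ᵇ y) * extensions k (suc e) y
    distrib : ∀ c a k b → c * (a + k * b) ≡ c * a + k * (c * b)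
    distrib = solve-∀
    regroup : ∀ a b k → a + (b + k * a) ≡ b + suc k * a
    regroup = solve-∀
  extensions⁺-suc k zero          x = ∑-*-zero (allSubsets _) (x ⊆ᵇ_)
  extensions⁺-suc k (suc zero)    x = ∑-*-zero (allSubsets _) (x ⊆ᵇ_)
  extensions⁺-suc k (suc (suc e)) x = extensions-suc k (suc e) x

  chainsAbove : ∀ {n} → List (Subset n) → ℕ → Subset n → ℕ
  chainsAbove L k x = length (filterᵇ (λ s → isMultichain (x ∷ s)) (sequences L k))

  length-filterᵇ-map : {A B : Set} (p : B → Bool) (g : A → B) (L : List A) →
                       length (filterᵇ p (map g L)) ≡ length (filterᵇ (p ∘ g) L)
  length-filterᵇ-map p g []      = refl
  length-filterᵇ-map p g (x ∷ L) with p (g x)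
  ... | true  = cong suc (length-filterᵇ-map p g L)
  ... | false = length-filterᵇ-map p g L

  length-filterᵇ-∧ : {A : Set} (b : Bool) (q : A → Bool) (L : List A) →
                     length (filterᵇ (λ x → b ∧ q x) L) ≡ bool→ℕ b * length (filterᵇ q L)
  length-filterᵇ-∧ true  q L       = sym (+-identityʳ _)
  length-filterᵇ-∧ false q []      = refl
  length-filterᵇ-∧ false q (x ∷ L) = length-filterᵇ-∧ false q L

  chainsAbove-suc : ∀ {n} (L : List (Subset n)) k x → chainsAbove L (suc k) x ≡ ∑[ y ∈ L ] ((x ⊆ᵇ y) * chainsAbove L k y)
  chainsAbove-suc L k x =
    trans (length-filterᵇ-concatMap _ (λ y → map (y ∷_) (sequences L k)) L) (∑-cong L λ y →
      trans (length-filterᵇ-map (λ s → isMultichain (x ∷ s)) (y ∷_) (sequences L k))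
            (length-filterᵇ-∧ (does (x ⊆? y)) (λ s → isMultichain (y ∷ s)) (sequences L k)))

  chainsAbove-extensions : ∀ {n} k (x : Subset n) → admissible 0 x ≡ true → chainsAbove (Admissible n) k x ≡ extensions k 0 x
  chainsAbove-extensions zero x h = sym (trans (extensions-zero 0 x) (cong bool→ℕ h))
  chainsAbove-extensions {n} (suc k) x h = begin
    chainsAbove (Admissible n) (suc k) x
      ≡⟨ chainsAbove-suc (Admissible n) k x ⟩
    ∑[ y ∈ Admissible n ] ((x ⊆ᵇ y) * chainsAbove (Admissible n) k y)
      ≡⟨ ∑-filterᵇ (admissible 0) (allSubsets n) _ ⟩
    ∑[ y ∈ allSubsets n ] (if admissible 0 y then (x ⊆ᵇ y) * chainsAbove (Admissible n) k y else 0)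
      ≡⟨ ∑-cong (allSubsets n) pointwise ⟩
    ∑[ y ∈ allSubsets n ] ((x ⊆ᵇ y) * extensions k 0 y)
      ≡⟨ extensions-suc k 0 x ⟩
    extensions (suc k) 0 x
      ∎
    where
    open ≡-Reasoning
    pointwise : ∀ y → (if admissible 0 y then (x ⊆ᵇ y) * chainsAbove (Admissible n) k y else 0) ≡ (x ⊆ᵇ y) * extensions k 0 y
    pointwise y with admissible 0 y in adm
    ... | true  = cong ((x ⊆ᵇ y) *_) (chainsAbove-extensions k y adm)
    ... | false = sym (trans (cong ((x ⊆ᵇ y) *_) (extensions-inadmissible k 0 y adm)) (*-zeroʳ (x ⊆ᵇ y)))

  admissible-∅ : ∀ n e → admissible e (∅ {n}) ≡ true
  admissible-∅ zero    e = refl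
  admissible-∅ (suc n) e = admissible-∅ n (suc e)

  ∅⊆ : ∀ {n} (y : Subset n) → does (∅ ⊆? y) ≡ true
  ∅⊆ []      = refl
  ∅⊆ (b ∷ y) = ∅⊆ y

  Z≡extensions : ∀ n i → Z n i ≡ extensions (i ∸ 1) 0 (∅ {n})
  Z≡extensions n i = begin
    length (filterᵇ isMultichain (sequences (𝒫 n) (i ∸ 1)))
      ≡⟨ cong (λ L → length (filterᵇ isMultichain (sequences L (i ∸ 1)))) (𝒫≡Admissible n) ⟩
    length (filterᵇ isMultichain (sequences (Admissible n) (i ∸ 1)))
      ≡⟨ cong length (filterᵇ-cong from-∅ (sequences (Admissible n) (i ∸ 1))) ⟩
    chainsAbove (Admissible n) (i ∸ 1) ∅
      ≡⟨ chainsAbove-extensions (i ∸ 1) ∅ (admissible-∅ n 0) ⟩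
    extensions (i ∸ 1) 0 (∅ {n})
      ∎
    where
    open ≡-Reasoning
    from-∅ : ∀ s → isMultichain s ≡ isMultichain (∅ ∷ s)
    from-∅ []      = refl
    from-∅ (y ∷ s) rewrite ∅⊆ y = refl

  extensions-∅ : ∀ n k e → extensions k e (∅ {n}) ≡ ∑[ S ∈ allSubsets n ] (if admissible e S then k ^ ∣ S ∣ else 0)
  extensions-∅ zero    k e = refl
  extensions-∅ (suc n) k e = begin
    extensions k (suc e) (∅ {n}) + k * extensions⁺ k e (∅ {n})
      ≡⟨ cong₂ _+_ (extensions-∅ n k (suc e)) (sym (member-sum e)) ⟩
    ∑ (allSubsets n) (weight (suc e)) + ∑[ S ∈ allSubsets n ] weight e (true ∷ S)
      ≡⟨ +-comm (∑ (allSubsets n) (weight (suc e))) _ ⟩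
    ∑[ S ∈ allSubsets n ] weight e (true ∷ S) + ∑ (allSubsets n) (weight (suc e))
      ≡⟨ ∑-allSubsets n (weight e) ⟨
    ∑ (allSubsets (suc n)) (weight e)
      ∎
    where
    open ≡-Reasoning
    weight : ∀ {m} → ℕ → Subset m → ℕ
    weight e S = if admissible e S then k ^ ∣ S ∣ else 0
    member-sum : ∀ e → ∑[ S ∈ allSubsets n ] weight e (true ∷ S) ≡ k * extensions⁺ k e (∅ {n})
    member-sum zero          = trans (∑-zero (allSubsets n)) (sym (*-zeroʳ k))
    member-sum (suc zero)    = trans (∑-zero (allSubsets n)) (sym (*-zeroʳ k))
    member-sum (suc (suc e)) = begin
      ∑[ S ∈ allSubsets n ] weight (suc (suc e)) (true ∷ S)
        ≡⟨ ∑-cong (allSubsets n) (λ S → k^suc (admissible (suc e) S) ∣ S ∣) ⟩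
      ∑[ S ∈ allSubsets n ] (k * weight (suc e) S)         ≡⟨ ∑-* (allSubsets n) k (weight (suc e)) ⟩
      k * ∑ (allSubsets n) (weight (suc e))               ≡⟨ cong (k *_) (extensions-∅ n k (suc e)) ⟨
      k * extensions k (suc e) (∅ {n})                    ∎
      where
      k^suc : ∀ b s → (if b then k ^ suc s else 0) ≡ k * (if b then k ^ s else 0)
      k^suc true  s = refl
      k^suc false s = sym (*-zeroʳ k)

  size-admissible : ∀ {n} e (S : Subset n) → admissible e S ≡ true → ∣ S ∣ + ∣ S ∣ ≤ (e + n) ∸ 1
  size-admissible {zero}  e             []          h = z≤n
  size-admissible {suc n} e             (false ∷ S) h =
    subst (λ c → ∣ S ∣ + ∣ S ∣ ≤ c ∸ 1) (sym (+-suc e n)) (size-admissible (suc e) S h)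
  size-admissible {suc n} (suc (suc e)) (true ∷ S)  h =
    subst₂ _≤_ (sym (+-suc (suc ∣ S ∣) ∣ S ∣)) (sym (cong suc (+-suc e n))) (s≤s (s≤s (size-admissible (suc e) S h)))

  size-bound : ∀ {n} (S : Subset n) → admissible 0 S ≡ true → ∣ S ∣ ≤ m n
  size-bound {n} S h = subst (_≤ m n) (m*n/n≡m ∣ S ∣ 2)
                             (/-monoˡ-≤ 2 (subst (_≤ n ∸ 1) (double ∣ S ∣) (size-admissible 0 S h)))
    where
    double : ∀ a → a + a ≡ a * 2
    double = solve-∀

  ∑-upTo-suc : ∀ N (f : ℕ → ℕ) → ∑ (upTo (suc N)) f ≡ f 0 + ∑[ j ∈ upTo N ] f (suc j)
  ∑-upTo-suc N f = cong (f 0 +_) (trans (cong (λ L → ∑ L f) (sym (map-applyUpTo (λ j → j) suc N))) (∑-map suc (upTo N) f))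

  ∑-upTo-≡ᵇ : ∀ N s (g : ℕ → ℕ) → s ≤ N → ∑[ j ∈ upTo (suc N) ] (bool→ℕ (s ≡ᵇ j) * g j) ≡ g s
  ∑-upTo-≡ᵇ N zero g _ = begin
    ∑[ j ∈ upTo (suc N) ] (bool→ℕ (0 ≡ᵇ j) * g j)   ≡⟨ ∑-upTo-suc N (λ j → bool→ℕ (0 ≡ᵇ j) * g j) ⟩
    g 0 + 0 + ∑[ j ∈ upTo N ] 0                       ≡⟨ cong₂ _+_ (+-identityʳ (g 0)) (∑-zero (upTo N)) ⟩
    g 0 + 0                                           ≡⟨ +-identityʳ (g 0) ⟩
    g 0                                               ∎
    where open ≡-Reasoning
  ∑-upTo-≡ᵇ (suc N) (suc s) g (s≤s s≤N) =
    trans (∑-upTo-suc (suc N) (λ j → bool→ℕ (suc s ≡ᵇ j) * g j)) (∑-upTo-≡ᵇ N s (g ∘ suc) s≤N)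

  length-filterᵇ-∷ : {A : Set} (p : A → Bool) (x : A) (L : List A) →
                     length (filterᵇ p (x ∷ L)) ≡ bool→ℕ (p x) + length (filterᵇ p L)
  length-filterᵇ-∷ p x L with p x
  ... | true  = refl
  ... | false = refl

  ∑-bySize : {A : Set} (s : A → ℕ) (g : ℕ → ℕ) (N : ℕ) (L : List A) → All (λ x → s x ≤ N) L →
             ∑[ x ∈ L ] g (s x) ≡ ∑[ j ∈ upTo (suc N) ] (length (filterᵇ (λ x → s x ≡ᵇ j) L) * g j)
  ∑-bySize s g N []      _            = sym (∑-zero (upTo (suc N)))
  ∑-bySize s g N (x ∷ L) (sx≤N All.∷ bounds) = sym (begin
    ∑[ j ∈ upTo (suc N) ] (length (filterᵇ (λ y → s y ≡ᵇ j) (x ∷ L)) * g j)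
      ≡⟨ ∑-cong (upTo (suc N)) (λ j → trans (cong (_* g j) (length-filterᵇ-∷ (λ y → s y ≡ᵇ j) x L))
                                            (*-distribʳ-+ (g j) (bool→ℕ (s x ≡ᵇ j)) _)) ⟩
    ∑[ j ∈ upTo (suc N) ] (bool→ℕ (s x ≡ᵇ j) * g j + length (filterᵇ (λ y → s y ≡ᵇ j) L) * g j)
      ≡⟨ ∑-+ (upTo (suc N)) (λ j → bool→ℕ (s x ≡ᵇ j) * g j) (λ j → length (filterᵇ (λ y → s y ≡ᵇ j) L) * g j) ⟩
    ∑[ j ∈ upTo (suc N) ] (bool→ℕ (s x ≡ᵇ j) * g j)
      + ∑[ j ∈ upTo (suc N) ] (length (filterᵇ (λ y → s y ≡ᵇ j) L) * g j)
      ≡⟨ cong₂ _+_ (∑-upTo-≡ᵇ N (s x) g sx≤N) (sym (∑-bySize s g N L bounds)) ⟩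
    g (s x) + ∑[ y ∈ L ] g (s y)
      ∎)
    where open ≡-Reasoning

  Z≡∑pcount : ∀ n i → Z n i ≡ ∑[ j ∈ upTo (suc (m n)) ] (pcount n j * (i ∸ 1) ^ j)
  Z≡∑pcount n i = begin
    Z n i
      ≡⟨ Z≡extensions n i ⟩
    extensions (i ∸ 1) 0 (∅ {n})
      ≡⟨ extensions-∅ n (i ∸ 1) 0 ⟩
    ∑[ S ∈ allSubsets n ] (if admissible 0 S then (i ∸ 1) ^ ∣ S ∣ else 0)
      ≡⟨ ∑-filterᵇ (admissible 0) (allSubsets n) _ ⟨
    ∑[ S ∈ Admissible n ] ((i ∸ 1) ^ ∣ S ∣)
      ≡⟨ ∑-bySize ∣_∣ ((i ∸ 1) ^_) (m n) (Admissible n) sizes ⟩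
    ∑[ j ∈ upTo (suc (m n)) ] (length (filterᵇ (λ S → ∣ S ∣ ≡ᵇ j) (Admissible n)) * (i ∸ 1) ^ j)
      ≡⟨ cong (λ L → ∑[ j ∈ upTo (suc (m n)) ] (length (filterᵇ (λ S → ∣ S ∣ ≡ᵇ j) L) * (i ∸ 1) ^ j))
              (𝒫≡Admissible n) ⟨
    ∑[ j ∈ upTo (suc (m n)) ] (pcount n j * (i ∸ 1) ^ j)
      ∎
    where
    open ≡-Reasoning
    sizes : All (λ S → ∣ S ∣ ≤ m n) (Admissible n)
    sizes = All.map (λ {S} → size-bound S ∘ T→≡true) (all-filter (T? ∘ admissible 0) (allSubsets n))

  -- Adjoining n + 1

  -- endingAt k n e d = ∑ of k ^ ∣ S ∣ over the S ⊆ [n] with admissible e S whose final slack is d.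
  endingAt endingAt⁺ : ℕ → ℕ → ℕ → ℕ → ℕ
  endingAt k zero    e d = bool→ℕ (e ≡ᵇ d)
  endingAt k (suc n) e d = endingAt k n (suc e) d + k * endingAt⁺ k n e d
  endingAt⁺ k n zero          d = 0
  endingAt⁺ k n (suc zero)    d = 0
  endingAt⁺ k n (suc (suc e)) d = endingAt k n (suc e) d

  -- The value n + 1 may join an admissible S ⊆ [n] exactly when S ends with slack at least 2.
  extensions-∅-suc : ∀ k n e → extensions k e (∅ {suc n}) + k * (endingAt k n e 0 + endingAt k n e 1)
                                ≡ suc k * extensions k e (∅ {n})
  extensions⁺-∅-suc : ∀ k n e → extensions⁺ k e (∅ {suc n}) + k * (endingAt⁺ k n e 0 + endingAt⁺ k n e 1)
                                 ≡ suc k * extensions⁺ k e (∅ {n})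
  extensions-∅-suc k zero e = base (extensions⁺ k e []) (endingAt k 0 e 0 + endingAt k 0 e 1) (one-ending e)
    where
    base : ∀ a b → a + b ≡ 1 → 1 + k * a + k * b ≡ suc k * 1
    base a b a+b≡1 = trans (split k a b) (cong (λ c → 1 + k * c) a+b≡1)
      where
      split : ∀ k a b → 1 + k * a + k * b ≡ 1 + k * (a + b)
      split = solve-∀
    one-ending : ∀ e → extensions⁺ k e [] + (endingAt k 0 e 0 + endingAt k 0 e 1) ≡ 1
    one-ending zero          = refl
    one-ending (suc zero)    = refl
    one-ending (suc (suc e)) = refl
  extensions-∅-suc k (suc n) e =
    trans (regroup (extensions k (suc e) (∅ {suc n})) (extensions⁺ k e (∅ {suc n})) k
                   (endingAt k n (suc e) 0) (endingAt k n (suc e) 1) (endingAt⁺ k n e 0) (endingAt⁺ k n e 1))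
          (trans (cong₂ (λ a b → a + k * b) (extensions-∅-suc k n (suc e)) (extensions⁺-∅-suc k n e))
                 (factor (extensions k (suc e) (∅ {n})) (extensions⁺ k e (∅ {n})) k))
    where
    regroup : ∀ a b k e₀ e₁ e₀′ e₁′ →
              a + k * b + k * ((e₀ + k * e₀′) + (e₁ + k * e₁′)) ≡ (a + k * (e₀ + e₁)) + k * (b + k * (e₀′ + e₁′))
    regroup = solve-∀
    factor : ∀ a b k → suc k * a + k * (suc k * b) ≡ suc k * (a + k * b)
    factor = solve-∀
  extensions⁺-∅-suc k n zero          = trans (*-zeroʳ k) (sym (*-zeroʳ (suc k)))
  extensions⁺-∅-suc k n (suc zero)    = trans (*-zeroʳ k) (sym (*-zeroʳ (suc k)))
  extensions⁺-∅-suc k n (suc (suc e)) = extensions-∅-suc k n (suc e)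

  endingAt-suc-vanishes : ∀ k n e d → endingAt k n (suc e) d ≡ 0 → endingAt⁺ k n e d ≡ 0 → endingAt k (suc n) e d ≡ 0
  endingAt-suc-vanishes k n e d p q = trans (cong₂ (λ a b → a + k * b) p q) (*-zeroʳ k)

  ≡ᵇ-false : ∀ {x y} → x ≢ y → (x ≡ᵇ y) ≡ false
  ≡ᵇ-false {x} {y} x≢y = ¬T→≡false (x≢y ∘ ≡ᵇ⇒≡ x y)

  endingAt-slack-0 : ∀ k n e → endingAt k n (suc e) 0 ≡ 0
  endingAt-slack-0 k zero    e       = refl
  endingAt-slack-0 k (suc n) zero    = endingAt-suc-vanishes k n 1 0 (endingAt-slack-0 k n 1) refl
  endingAt-slack-0 k (suc n) (suc e) =
    endingAt-suc-vanishes k n (suc (suc e)) 0 (endingAt-slack-0 k n (suc (suc e))) (endingAt-slack-0 k n e)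

  endingAt-below : ∀ k n e d → d + n < e → endingAt k n e d ≡ 0
  endingAt-below k zero          e             d d<e = cong bool→ℕ (≡ᵇ-false (>⇒≢ (subst (_< e) (+-identityʳ d) d<e)))
  endingAt-below k (suc n)       (suc (suc e)) d h   =
    endingAt-suc-vanishes k n (suc (suc e)) d (endingAt-below k n (suc (suc (suc e))) d (<-trans (n<1+n _) (m<n⇒m<1+n h′)))
                                              (endingAt-below k n (suc e) d (≤-pred h′))
    where
    h′ : suc (d + n) < suc (suc e)
    h′ = subst (_< suc (suc e)) (+-suc d n) h
  endingAt-below k (suc n) zero       d h with () ← h
  endingAt-below k (suc n) (suc zero) d h with s≤s () ← subst (_< 1) (+-suc d n) h

  endingAt-above : ∀ k n e d → e + n < d → endingAt k n e d ≡ 0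
  endingAt⁺-above : ∀ k n e d → e + n ≤ d → endingAt⁺ k n e d ≡ 0
  endingAt-above k zero    e d e<d = cong bool→ℕ (≡ᵇ-false (<⇒≢ (subst (_< d) (+-identityʳ e) e<d)))
  endingAt-above k (suc n) e d h   =
    endingAt-suc-vanishes k n e d (endingAt-above k n (suc e) d (subst (_< d) (+-suc e n) h))
                                  (endingAt⁺-above k n e d (≤-trans (+-monoʳ-≤ e (n≤1+n n)) (<⇒≤ h)))
  endingAt⁺-above k n zero          d _ = refl
  endingAt⁺-above k n (suc zero)    d _ = refl
  endingAt⁺-above k n (suc (suc e)) d h = endingAt-above k n (suc e) d h

  ε-double : ∀ d → ε (d + d) ≡ 0
  ε-double zero    = refl
  ε-double (suc d) rewrite +-suc d d = ε-double d

  -- Every value moves the slack by one, so the parity of e + n + d is even.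
  endingAt-parity : ∀ k n e d → ε (n + e + d) ≡ 1 → endingAt k n e d ≡ 0
  endingAt-parity k zero e d odd with e ≡ᵇ d in eq
  ... | false = refl
  ... | true with refl ← ≡ᵇ⇒≡ e d (subst T (sym eq) _) with () ← trans (sym (ε-double e)) odd
  endingAt-parity k (suc n) e d odd =
    endingAt-suc-vanishes k n e d (endingAt-parity k n (suc e) d (trans (cong ε (reassoc n e d)) odd)) (member e odd)
    where
    reassoc : ∀ n e d → n + suc e + d ≡ suc n + e + d
    reassoc = solve-∀
    reassoc₂ : ∀ n e d → suc n + suc (suc e) + d ≡ suc (suc (n + suc e + d))
    reassoc₂ = solve-∀
    member : ∀ e → ε (suc n + e + d) ≡ 1 → endingAt⁺ k n e d ≡ 0
    member zero          _   = refl
    member (suc zero)    _   = refl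
    member (suc (suc e)) odd = endingAt-parity k n (suc e) d (trans (cong ε (sym (reassoc₂ n e d))) odd)

  -- Ballot numbers

  binomial : ℕ → ℕ → ℕ
  binomial n       zero    = 1
  binomial zero    (suc j) = 0
  binomial (suc n) (suc j) = binomial n j + binomial n (suc j)

  binomial-> : ∀ {n j} → n < j → binomial n j ≡ 0
  binomial-> {zero}  {suc j} _         = refl
  binomial-> {suc n} {suc j} (s≤s n<j) = cong₂ _+_ (binomial-> n<j) (binomial-> (m<n⇒m<1+n n<j))

  -- Reflection principle: with a non-members and b members, the slack goes from e + 1 to d, and the
  -- sequences that would go below 1 correspond to those from -(e + 1) to d, which have b + d up-steps.
  endingAt-ballot : ∀ k n a b e d → a + b ≡ n → d + b ≡ a + suc e →
                    endingAt k n (suc e) d + k ^ b * binomial n (b + d) ≡ k ^ b * binomial n a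
  endingAt-ballot k zero zero zero e d refl h with refl ← trans (sym (+-identityʳ d)) h
    rewrite T→≡true (≡⇒≡ᵇ e e refl) = refl
  endingAt-ballot k (suc n) zero (suc n) zero d refl h
    with refl ← m+n≡0⇒m≡0 d (suc-injective (trans (sym (+-suc d n)) h))
       | refl ← m+n≡0⇒n≡0 d (suc-injective (trans (sym (+-suc d n)) h)) = arith k
    where
    arith : ∀ k → 0 + k * 0 + k * 1 * 1 ≡ k * 1 * 1
    arith = solve-∀
  endingAt-ballot k (suc n) zero (suc n) (suc e) d refl h = begin
    (endingAt k n (3 + e) d + k * endingAt k n (suc e) d) + k * k ^ n * (binomial n (n + d) + binomial n (suc (n + d)))
      ≡⟨ cong₂ (λ u v → (u + k * endingAt k n (suc e) d) + k * k ^ n * (binomial n (n + d) + v))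
               (endingAt-below k n (3 + e) d (≤-trans (s≤s (≤-reflexive h′)) (n≤1+n _))) (binomial-> (s≤s (m≤m+n n d))) ⟩
    (0 + k * endingAt k n (suc e) d) + k * k ^ n * (binomial n (n + d) + 0)
      ≡⟨ arith k (k ^ n) (endingAt k n (suc e) d) (binomial n (n + d)) ⟩
    k * (endingAt k n (suc e) d + k ^ n * binomial n (n + d))
      ≡⟨ cong (k *_) (endingAt-ballot k n zero n e d refl h′) ⟩
    k * (k ^ n * 1)
      ≡⟨ *-assoc k (k ^ n) 1 ⟨
    k * k ^ n * 1
      ∎
    where
    open ≡-Reasoning
    h′ : d + n ≡ suc e
    h′ = suc-injective (trans (sym (+-suc d n)) h)
    arith : ∀ k K E B → (0 + k * E) + k * K * (B + 0) ≡ k * (E + K * B)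
    arith = solve-∀
  endingAt-ballot k n (suc a) zero e d eq h
    with refl ← trans (sym (+-identityʳ (suc a))) eq | refl ← trans (sym (+-identityʳ d)) h = begin
    (endingAt k a (2 + e) d + k * endingAt⁺ k a (suc e) d) + 1 * (binomial a (a + suc e) + binomial a d)
      ≡⟨ cong₂ (λ u v → (endingAt k a (2 + e) d + k * u) + 1 * (v + binomial a d))
               (endingAt⁺-above k a (suc e) d (s≤s (≤-trans (≤-reflexive (+-comm e a)) (+-monoʳ-≤ a (n≤1+n e)))))
               (binomial-> (m<m+n a (s≤s z≤n))) ⟩
    (endingAt k a (2 + e) d + k * 0) + 1 * (0 + binomial a d)
      ≡⟨ arith k (endingAt k a (2 + e) d) (binomial a d) ⟩
    endingAt k a (2 + e) d + 1 * binomial a d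
      ≡⟨ endingAt-ballot k a a zero (suc e) d (+-identityʳ a) (trans (+-identityʳ d) (sym (+-suc a (suc e)))) ⟩
    1 * binomial a a
      ≡⟨ cong (λ v → 1 * v) (trans (cong (binomial a a +_) (binomial-> (n<1+n a))) (+-identityʳ _)) ⟨
    1 * (binomial a a + binomial a (suc a))
      ∎
    where
    open ≡-Reasoning
    arith : ∀ k E B → (E + k * 0) + 1 * (0 + B) ≡ E + 1 * B
    arith = solve-∀
  endingAt-ballot k .(suc (a + suc b)) (suc a) (suc b) zero d refl h = begin
    (endingAt k n′ 2 d + k * 0) + K * (binomial n′ (b + d) + binomial n′ (suc (b + d)))
      ≡⟨ cong (λ j → (endingAt k n′ 2 d + k * 0) + K * (binomial n′ j + binomial n′ (suc (b + d)))) b+d≡1+a ⟩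
    (endingAt k n′ 2 d + k * 0) + K * (binomial n′ (suc a) + binomial n′ (suc (b + d)))
      ≡⟨ arith k K (endingAt k n′ 2 d) (binomial n′ (suc a)) (binomial n′ (suc (b + d))) ⟩
    (endingAt k n′ 2 d + K * binomial n′ (suc (b + d))) + K * binomial n′ (suc a)
      ≡⟨ cong (_+ K * binomial n′ (suc a)) (endingAt-ballot k n′ a (suc b) 1 d refl (trans h (sym (+-suc a 1)))) ⟩
    K * binomial n′ a + K * binomial n′ (suc a)
      ≡⟨ *-distribˡ-+ K (binomial n′ a) (binomial n′ (suc a)) ⟨
    K * (binomial n′ a + binomial n′ (suc a))
      ∎
    where
    open ≡-Reasoning
    n′ = a + suc b
    K = k ^ suc b
    b+d≡1+a : b + d ≡ suc a
    b+d≡1+a = trans (+-comm b d) (suc-injective (trans (sym (+-suc d b)) (trans h (cong suc (+-comm a 1)))))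
    arith : ∀ k K E B₀ B₁ → (E + k * 0) + K * (B₀ + B₁) ≡ (E + K * B₁) + K * B₀
    arith = solve-∀
  endingAt-ballot k .(suc (a + suc b)) (suc a) (suc b) (suc e) d refl h = begin
    (endingAt k n′ (3 + e) d + k * endingAt k n′ (suc e) d) + k * K * (binomial n′ (b + d) + binomial n′ (suc (b + d)))
      ≡⟨ arith k K (endingAt k n′ (3 + e) d) (endingAt k n′ (suc e) d) (binomial n′ (b + d)) (binomial n′ (suc (b + d))) ⟩
    (endingAt k n′ (3 + e) d + k * K * binomial n′ (suc (b + d))) + k * (endingAt k n′ (suc e) d + K * binomial n′ (b + d))
      ≡⟨ cong₂ (λ u v → u + k * v) (endingAt-ballot k n′ a (suc b) (2 + e) d refl (trans h (sym (+-suc a (2 + e)))))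
                                   (endingAt-ballot k n′ (suc a) b e d (sym (+-suc a b)) h₂) ⟩
    k * K * binomial n′ a + k * (K * binomial n′ (suc a))
      ≡⟨ factor k K (binomial n′ a) (binomial n′ (suc a)) ⟩
    k * K * (binomial n′ a + binomial n′ (suc a))
      ∎
    where
    open ≡-Reasoning
    n′ = a + suc b
    K = k ^ b
    h₂ : d + b ≡ suc a + suc e
    h₂ = suc-injective (trans (sym (+-suc d b)) (trans h (cong suc (+-suc a (suc e)))))
    arith : ∀ k K E E′ B₀ B₁ → (E + k * E′) + k * K * (B₀ + B₁) ≡ (E + k * K * B₁) + k * (E′ + K * B₀)
    arith = solve-∀
    factor : ∀ k K B₀ B₁ → k * K * B₀ + k * (K * B₁) ≡ k * K * (B₀ + B₁)
    factor = solve-∀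

  C≡binomial : ∀ n j → n C j ≡ binomial n j
  C≡binomial n       zero    = refl
  C≡binomial zero    (suc j) = k>n⇒nCk≡0 {0} {suc j} (s≤s z≤n)
  C≡binomial (suc n) (suc j) = trans (sym (nCk+nC[k+1]≡[n+1]C[k+1] n j)) (cong₂ _+_ (C≡binomial n j) (C≡binomial n (suc j)))

  binomial-1 : ∀ n → binomial n 1 ≡ n
  binomial-1 zero    = refl
  binomial-1 (suc n) = cong suc (binomial-1 n)

  binomial-absorption : ∀ n j → suc j * binomial n (suc j) + j * binomial n j ≡ n * binomial n j
  binomial-absorption zero    zero    = refl
  binomial-absorption zero    (suc j) = cong₂ _+_ (*-zeroʳ (suc (suc j))) (*-zeroʳ (suc j))
  binomial-absorption (suc n) zero    =
    trans (+-identityʳ _) (trans (*-identityˡ _) (trans (cong suc (binomial-1 n)) (sym (*-identityʳ (suc n)))))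
  binomial-absorption (suc n) (suc j) =
    trans (expand n j B₀ B₁ B₂)
          (trans (cong₂ (λ u v → u + v + B₁ + B₀) (binomial-absorption n (suc j)) (binomial-absorption n j)) (collect n B₀ B₁))
    where
    B₀ = binomial n j
    B₁ = binomial n (suc j)
    B₂ = binomial n (suc (suc j))
    expand : ∀ n j B₀ B₁ B₂ → suc (suc j) * (B₁ + B₂) + suc j * (B₀ + B₁)
                              ≡ (suc (suc j) * B₂ + suc j * B₁) + (suc j * B₁ + j * B₀) + B₁ + B₀
    expand = solve-∀
    collect : ∀ n B₀ B₁ → n * B₁ + n * B₀ + B₁ + B₀ ≡ suc n * (B₀ + B₁)
    collect = solve-∀

  endingAt-catalan : ∀ k j → suc j * endingAt k (j + j) 1 1 ≡ k ^ j * binomial (j + j) j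
  endingAt-catalan k j = +-cancelʳ-≡ (K * (j * B₀)) (suc j * E) (K * B₀) (begin
    suc j * E + K * (j * B₀)              ≡⟨ cong (λ c → suc j * E + K * c) absorbed ⟨
    suc j * E + K * (suc j * B₁)          ≡⟨ distrib j E K B₁ ⟩
    suc j * (E + K * B₁)                  ≡⟨ cong (suc j *_) ballot ⟩
    suc j * (K * B₀)                      ≡⟨ spread j K B₀ ⟩
    K * B₀ + K * (j * B₀)                 ∎)
    where
    open ≡-Reasoning
    E = endingAt k (j + j) 1 1
    K = k ^ j
    B₀ = binomial (j + j) j
    B₁ = binomial (j + j) (suc j)
    ballot : E + K * B₁ ≡ K * B₀
    ballot = subst (λ i → E + K * binomial (j + j) i ≡ K * B₀) (+-comm j 1) (endingAt-ballot k (j + j) j j 0 1 refl (+-comm 1 j))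
    absorbed : suc j * B₁ ≡ j * B₀
    absorbed = +-cancelʳ-≡ (j * B₀) (suc j * B₁) (j * B₀) (trans (binomial-absorption (j + j) j) (*-distribʳ-+ B₀ j j))
    distrib : ∀ j E K B₁ → suc j * E + K * (suc j * B₁) ≡ suc j * (E + K * B₁)
    distrib = solve-∀
    spread : ∀ j K B₀ → suc j * (K * B₀) ≡ K * B₀ + K * (j * B₀)
    spread = solve-∀

  Z-suc : ∀ k n → Z (suc (suc n)) (suc k) + k * endingAt k n 1 1 ≡ suc k * Z (suc n) (suc k)
  Z-suc k n = begin
    Z (suc (suc n)) (suc k) + k * endingAt k n 1 1
      ≡⟨ cong₂ (λ z e → z + k * e) (Z≡extensions (suc (suc n)) (suc k)) (sym final-1) ⟩
    extensions k 0 (∅ {suc (suc n)}) + k * (0 + endingAt k (suc n) 0 1)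
      ≡⟨ cong (λ e → extensions k 0 (∅ {suc (suc n)}) + k * (e + endingAt k (suc n) 0 1)) final-0 ⟨
    extensions k 0 (∅ {suc (suc n)}) + k * (endingAt k (suc n) 0 0 + endingAt k (suc n) 0 1)
      ≡⟨ extensions-∅-suc k (suc n) 0 ⟩
    suc k * extensions k 0 (∅ {suc n})
      ≡⟨ cong (suc k *_) (Z≡extensions (suc n) (suc k)) ⟨
    suc k * Z (suc n) (suc k)
      ∎
    where
    open ≡-Reasoning
    final-0 : endingAt k (suc n) 0 0 ≡ 0
    final-0 = endingAt-suc-vanishes k n 0 0 (endingAt-slack-0 k n 0) refl
    final-1 : endingAt k (suc n) 0 1 ≡ endingAt k n 1 1
    final-1 = trans (cong (endingAt k n 1 1 +_) (*-zeroʳ k)) (+-identityʳ _)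


open import Data.Nat using (ℕ; _≤_; _∸_; suc; zero; s≤s; z≤n)
open import Data.Product using (_×_)
open import Relation.Binary.PropositionalEquality using (_≡_)
open import Data.Rational using (_*_; _-_)

import Data.Nat as ℕ
import Data.Nat.Properties as ℕ
open import Data.Nat.DivMod using (m*n/n≡m)
open import Data.Nat.Tactic.RingSolver using (solve-∀)
open import Data.Integer using (+_)
import Data.Integer as ℤ
import Data.Integer.Properties as ℤ
import Data.Integer.Tactic.RingSolver as ℤ
open import Data.Rational using (ℚ; 0ℚ; 1ℚ; _+_; -_; fromℚᵘ) renaming (_/_ to _÷_)
open import Data.Rational.Properties
  using (toℚᵘ-injective; toℚᵘ-fromℚᵘ; toℚᵘ-homo-+; toℚᵘ-homo-*; fromℚᵘ-cong; 0/n≡0;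
         *-identityˡ; *-identityʳ; *-zeroʳ; *-assoc; *-distribˡ-+)
open import Data.Rational.Solver using (module +-*-Solver)
open +-*-Solver using (solve; _:+_; _:-_; _:*_; _:=_)
import Data.Rational.Unnormalised as ℚᵘ
import Data.Rational.Unnormalised.Properties as ℚᵘ
open import Data.List using (List; []; _∷_; map; upTo)
open import Data.List.Membership.Propositional using (_∈_)
open import Data.List.Relation.Unary.Any using (here; there)
open import Data.List.Membership.Propositional.Properties using (∈-applyUpTo⁻)
open import Data.Sum using (_⊎_; inj₁; inj₂)
open import Data.Product using (_,_; ∃)
open import Relation.Binary.PropositionalEquality using (refl; sym; trans; cong; cong₂; module ≡-Reasoning)
open Combinatorics using (∑; Z≡∑pcount; Z≡extensions; Z-suc; endingAt; endingAt-catalan; endingAt-parity; binomial; C≡binomial; ε-double)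

fromℚᵘ-+ : ∀ p q → fromℚᵘ (p ℚᵘ.+ q) ≡ fromℚᵘ p + fromℚᵘ q
fromℚᵘ-+ p q = toℚᵘ-injective (ℚᵘ.≃-trans (toℚᵘ-fromℚᵘ (p ℚᵘ.+ q))
  (ℚᵘ.≃-trans (ℚᵘ.+-cong (ℚᵘ.≃-sym (toℚᵘ-fromℚᵘ p)) (ℚᵘ.≃-sym (toℚᵘ-fromℚᵘ q)))
              (ℚᵘ.≃-sym (toℚᵘ-homo-+ (fromℚᵘ p) (fromℚᵘ q)))))

fromℚᵘ-* : ∀ p q → fromℚᵘ (p ℚᵘ.* q) ≡ fromℚᵘ p * fromℚᵘ q
fromℚᵘ-* p q = toℚᵘ-injective (ℚᵘ.≃-trans (toℚᵘ-fromℚᵘ (p ℚᵘ.* q))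
  (ℚᵘ.≃-trans (ℚᵘ.*-cong (ℚᵘ.≃-sym (toℚᵘ-fromℚᵘ p)) (ℚᵘ.≃-sym (toℚᵘ-fromℚᵘ q)))
              (ℚᵘ.≃-sym (toℚᵘ-homo-* (fromℚᵘ p) (fromℚᵘ q)))))

ℕ→ℚ-+ : ∀ a b → ℕ→ℚ (a ℕ.+ b) ≡ ℕ→ℚ a + ℕ→ℚ b
ℕ→ℚ-+ a b = trans (fromℚᵘ-cong {ℚᵘ.mkℚᵘ (+ (a ℕ.+ b)) 0} {ℚᵘ.mkℚᵘ (+ a) 0 ℚᵘ.+ ℚᵘ.mkℚᵘ (+ b) 0}
                    (ℚᵘ.*≡* (trans (cong (λ x → x ℤ.* (+ 1 ℤ.* + 1)) (ℤ.pos-+ a b)) (arith (+ a) (+ b)))))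
                  (fromℚᵘ-+ (ℚᵘ.mkℚᵘ (+ a) 0) (ℚᵘ.mkℚᵘ (+ b) 0))
  where
  arith : ∀ x y → (x ℤ.+ y) ℤ.* (+ 1 ℤ.* + 1) ≡ (x ℤ.* + 1 ℤ.+ y ℤ.* + 1) ℤ.* + 1
  arith = ℤ.solve-∀

ℕ→ℚ-* : ∀ a b → ℕ→ℚ (a ℕ.* b) ≡ ℕ→ℚ a * ℕ→ℚ b
ℕ→ℚ-* a b = trans (fromℚᵘ-cong {ℚᵘ.mkℚᵘ (+ (a ℕ.* b)) 0} {ℚᵘ.mkℚᵘ (+ a) 0 ℚᵘ.* ℚᵘ.mkℚᵘ (+ b) 0}
                    (ℚᵘ.*≡* (trans (cong (λ x → x ℤ.* (+ 1 ℤ.* + 1)) (ℤ.pos-* a b)) (arith (+ a) (+ b)))))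
                  (fromℚᵘ-* (ℚᵘ.mkℚᵘ (+ a) 0) (ℚᵘ.mkℚᵘ (+ b) 0))
  where
  arith : ∀ x y → x ℤ.* y ℤ.* (+ 1 ℤ.* + 1) ≡ x ℤ.* y ℤ.* + 1
  arith = ℤ.solve-∀

ℕ→ℚ-^ : ∀ a j → ℕ→ℚ (a ℕ.^ j) ≡ ℕ→ℚ a ^ℚ j
ℕ→ℚ-^ a zero    = refl
ℕ→ℚ-^ a (suc j) = trans (ℕ→ℚ-* a (a ℕ.^ j)) (cong (ℕ→ℚ a *_) (ℕ→ℚ-^ a j))

ℕ→ℚ-/ : ∀ a q → (+ (a ℕ.* suc q)) ÷ suc q ≡ ℕ→ℚ a
ℕ→ℚ-/ a q = fromℚᵘ-cong {ℚᵘ.mkℚᵘ (+ (a ℕ.* suc q)) q} {ℚᵘ.mkℚᵘ (+ a) 0}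
                         (ℚᵘ.*≡* (trans (ℤ.*-identityʳ _) (ℤ.pos-* a (suc q))))

ℕ→ℚ*recip : ∀ k → ℕ→ℚ (suc k) * recip (suc k) ≡ 1ℚ
ℕ→ℚ*recip k = trans (sym (fromℚᵘ-* (ℚᵘ.mkℚᵘ (+ suc k) 0) (ℚᵘ.mkℚᵘ (+ 1) k)))
                    (fromℚᵘ-cong {ℚᵘ.mkℚᵘ (+ suc k) 0 ℚᵘ.* ℚᵘ.mkℚᵘ (+ 1) k} {ℚᵘ.mkℚᵘ (+ 1) 0}
                                 (ℚᵘ.*≡* (arith (+ suc k))))
  where
  arith : ∀ x → x ℤ.* + 1 ℤ.* + 1 ≡ + 1 ℤ.* (+ 1 ℤ.* x)
  arith = ℤ.solve-∀

ℕ→ℚ-∑ : (L : List ℕ) (f : ℕ → ℕ) → ℕ→ℚ (∑ L f) ≡ sumℚ (map (λ j → ℕ→ℚ (f j)) L)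
ℕ→ℚ-∑ []      f = refl
ℕ→ℚ-∑ (x ∷ L) f = trans (ℕ→ℚ-+ (f x) (∑ L f)) (cong (λ q → ℕ→ℚ (f x) + q) (ℕ→ℚ-∑ L f))

sumℚ-* : ∀ c (g : ℕ → ℚ) L → c * sumℚ (map g L) ≡ sumℚ (map (λ j → c * g j) L)
sumℚ-* c g []      = *-zeroʳ c
sumℚ-* c g (x ∷ L) = trans (*-distribˡ-+ c (g x) _) (cong (λ q → c * g x + q) (sumℚ-* c g L))

sumℚ-cong : ∀ {f g : ℕ → ℚ} L → (∀ j → j ∈ L → f j ≡ g j) → sumℚ (map f L) ≡ sumℚ (map g L)
sumℚ-cong []      f≗g = refl
sumℚ-cong (x ∷ L) f≗g = cong₂ _+_ (f≗g x (here refl)) (sumℚ-cong L (λ j j∈ → f≗g j (there j∈)))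

^ℚ-+ : ∀ x a b → x ^ℚ (a ℕ.+ b) ≡ (x ^ℚ a) * (x ^ℚ b)
^ℚ-+ x zero    b = sym (*-identityˡ _)
^ℚ-+ x (suc a) b = trans (cong (x *_) (^ℚ-+ x a b)) (sym (*-assoc x _ _))

^ℚ-inverse : ∀ x y j → x * y ≡ 1ℚ → (x ^ℚ j) * (y ^ℚ j) ≡ 1ℚ
^ℚ-inverse x y zero    xy≡1 = refl
^ℚ-inverse x y (suc j) xy≡1 =
  trans (interchange x y (x ^ℚ j) (y ^ℚ j)) (trans (cong₂ _*_ xy≡1 (^ℚ-inverse x y j xy≡1)) (*-identityˡ 1ℚ))
  where
  interchange : ∀ a b c d → (a * c) * (b * d) ≡ (a * b) * (c * d)
  interchange = solve 4 (λ a b c d → (a :* c) :* (b :* d) := (a :* b) :* (c :* d)) refl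

rescale-monomial : ∀ x y N j c → x * y ≡ 1ℚ → j ℕ.≤ N → (x ^ℚ N) * (c * (y ^ℚ (N ∸ j))) ≡ c * (x ^ℚ j)
rescale-monomial x y N j c xy≡1 j≤N = begin
  (x ^ℚ N) * (c * (y ^ℚ (N ∸ j)))                         ≡⟨ cong (λ e → (x ^ℚ e) * (c * (y ^ℚ (N ∸ j)))) (ℕ.m+[n∸m]≡n j≤N) ⟨
  (x ^ℚ (j ℕ.+ (N ∸ j))) * (c * (y ^ℚ (N ∸ j)))           ≡⟨ cong (_* (c * (y ^ℚ (N ∸ j)))) (^ℚ-+ x j (N ∸ j)) ⟩
  ((x ^ℚ j) * (x ^ℚ (N ∸ j))) * (c * (y ^ℚ (N ∸ j)))      ≡⟨ shuffle (x ^ℚ j) (x ^ℚ (N ∸ j)) c (y ^ℚ (N ∸ j)) ⟩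
  (c * (x ^ℚ j)) * ((x ^ℚ (N ∸ j)) * (y ^ℚ (N ∸ j)))      ≡⟨ cong ((c * (x ^ℚ j)) *_) (^ℚ-inverse x y (N ∸ j) xy≡1) ⟩
  (c * (x ^ℚ j)) * 1ℚ                                     ≡⟨ *-identityʳ _ ⟩
  c * (x ^ℚ j)                                            ∎
  where
  open ≡-Reasoning
  shuffle : ∀ a b c d → (a * b) * (c * d) ≡ (c * a) * (b * d)
  shuffle = solve 4 (λ a b c d → (a :* b) :* (c :* d) := (c :* a) :* (b :* d)) refl

∈-upTo⁻ : ∀ {j N} → j ∈ upTo N → j ℕ.< N
∈-upTo⁻ j∈ with ∈-applyUpTo⁻ (λ i → i) j∈
... | _ , i<N , refl = i<N

Z-fpoly : ∀ n i → 2 ≤ i → ℕ→ℚ (Z n i) ≡ (ℕ→ℚ (i ∸ 1) ^ℚ m n) * fpoly n (recip (i ∸ 1))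
Z-fpoly n (suc zero)    (s≤s ())
Z-fpoly n (suc (suc k)) _ = begin
  ℕ→ℚ (Z n (suc (suc k)))
    ≡⟨ cong ℕ→ℚ (Z≡∑pcount n (suc (suc k))) ⟩
  ℕ→ℚ (∑ (upTo (suc (m n))) (λ j → pcount n j ℕ.* suc k ℕ.^ j))
    ≡⟨ ℕ→ℚ-∑ (upTo (suc (m n))) (λ j → pcount n j ℕ.* suc k ℕ.^ j) ⟩
  sumℚ (map (λ j → ℕ→ℚ (pcount n j ℕ.* suc k ℕ.^ j)) (upTo (suc (m n))))
    ≡⟨ sumℚ-cong (upTo (suc (m n))) term ⟩
  sumℚ (map (λ j → (ℕ→ℚ (suc k) ^ℚ m n) * (ℕ→ℚ (pcount n j) * (recip (suc k) ^ℚ (m n ∸ j)))) (upTo (suc (m n))))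
    ≡⟨ sumℚ-* (ℕ→ℚ (suc k) ^ℚ m n) (λ j → ℕ→ℚ (pcount n j) * (recip (suc k) ^ℚ (m n ∸ j))) (upTo (suc (m n))) ⟨
  (ℕ→ℚ (suc k) ^ℚ m n) * fpoly n (recip (suc k))
    ∎
  where
  open ≡-Reasoning
  term : ∀ j → j ∈ upTo (suc (m n)) →
         ℕ→ℚ (pcount n j ℕ.* suc k ℕ.^ j) ≡ (ℕ→ℚ (suc k) ^ℚ m n) * (ℕ→ℚ (pcount n j) * (recip (suc k) ^ℚ (m n ∸ j)))
  term j j∈ = begin
    ℕ→ℚ (pcount n j ℕ.* suc k ℕ.^ j)
      ≡⟨ ℕ→ℚ-* (pcount n j) (suc k ℕ.^ j) ⟩
    ℕ→ℚ (pcount n j) * ℕ→ℚ (suc k ℕ.^ j)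
      ≡⟨ cong (ℕ→ℚ (pcount n j) *_) (ℕ→ℚ-^ (suc k) j) ⟩
    ℕ→ℚ (pcount n j) * (ℕ→ℚ (suc k) ^ℚ j)
      ≡⟨ rescale-monomial (ℕ→ℚ (suc k)) (recip (suc k)) (m n) j (ℕ→ℚ (pcount n j)) (ℕ→ℚ*recip k) (ℕ.≤-pred (∈-upTo⁻ j∈)) ⟨
    (ℕ→ℚ (suc k) ^ℚ m n) * (ℕ→ℚ (pcount n j) * (recip (suc k) ^ℚ (m n ∸ j)))
      ∎

parity : ∀ n → (∃ λ j → n ≡ j ℕ.+ j) ⊎ (∃ λ j → n ≡ suc (j ℕ.+ j))
parity zero    = inj₁ (0 , refl)
parity (suc n) with parity n
... | inj₁ (j , n≡j+j)   = inj₂ (j , cong suc n≡j+j)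
... | inj₂ (j , n≡1+j+j) = inj₁ (suc j , cong suc (trans n≡1+j+j (sym (ℕ.+-suc j j))))

plus-two : ∀ j → suc (j ℕ.+ j) ℕ.+ 1 ℕ.+ 1 ≡ suc (suc (suc (j ℕ.+ j)))
plus-two = solve-∀

ε-odd : ∀ j → ε (suc (j ℕ.+ j)) ≡ 1
ε-odd zero    = refl
ε-odd (suc j) rewrite ℕ.+-suc j j = ε-odd j

half : ∀ j → (j ℕ.+ j) ℕ./ 2 ≡ j
half j = trans (cong (ℕ._/ 2) (double j)) (m*n/n≡m j 2)
  where
  double : ∀ j → j ℕ.+ j ≡ j ℕ.* 2
  double = solve-∀

half-odd : ∀ j → (suc (j ℕ.+ j) ℕ.+ 1) ℕ./ 2 ≡ suc j
half-odd j = trans (cong (ℕ._/ 2) (double j)) (m*n/n≡m (suc j) 2)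
  where
  double : ∀ j → suc (j ℕ.+ j) ℕ.+ 1 ≡ suc j ℕ.* 2
  double = solve-∀

correction≡endingAt : ∀ k n → correction (suc n) (suc k) ≡ ℕ→ℚ (k ℕ.* endingAt k n 1 1)
correction≡endingAt k n with parity n
... | inj₁ (j , refl) rewrite ε-odd j | half j | half-odd j | C≡binomial (j ℕ.+ j) j =
  trans (cong (λ x → (+ x) ÷ suc (suc (j ℕ.+ j))) numerator) (ℕ→ℚ-/ (k ℕ.* endingAt k (j ℕ.+ j) 1 1) (suc (j ℕ.+ j)))
  where
  E = endingAt k (j ℕ.+ j) 1 1
  B = binomial (j ℕ.+ j) j
  regroup : ∀ k K B → 1 ℕ.* (2 ℕ.* (k ℕ.* K) ℕ.* B) ≡ 2 ℕ.* (k ℕ.* (K ℕ.* B))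
  regroup = solve-∀
  expand : ∀ k j E → 2 ℕ.* (k ℕ.* (suc j ℕ.* E)) ≡ k ℕ.* E ℕ.* suc (suc (j ℕ.+ j))
  expand = solve-∀
  numerator : 1 ℕ.* (2 ℕ.* (k ℕ.* k ℕ.^ j) ℕ.* B) ≡ k ℕ.* E ℕ.* suc (suc (j ℕ.+ j))
  numerator = trans (regroup k (k ℕ.^ j) B) (trans (cong (λ c → 2 ℕ.* (k ℕ.* c)) (sym (endingAt-catalan k j))) (expand k j E))
... | inj₂ (j , refl) rewrite ε-double j | endingAt-parity k (suc (j ℕ.+ j)) 1 1 (trans (cong ε (plus-two j)) (ε-odd j)) | ℕ.*-zeroʳ k =
  0/n≡0 (suc (suc (suc (j ℕ.+ j))))

ℕ→ℚ-+-cancelʳ : ∀ a b → ℕ→ℚ (a ℕ.+ b) - ℕ→ℚ b ≡ ℕ→ℚ a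
ℕ→ℚ-+-cancelʳ a b = trans (cong (_- ℕ→ℚ b) (ℕ→ℚ-+ a b)) (cancel (ℕ→ℚ a) (ℕ→ℚ b))
  where
  cancel : ∀ p q → (p + q) - q ≡ p
  cancel = solve 2 (λ p q → (p :+ q) :- q := p) refl

Z-recurrence : ∀ n i → 1 ≤ n → 2 ≤ i → ℕ→ℚ (Z (suc n) i) ≡ (ℕ→ℚ i * ℕ→ℚ (Z n i)) - correction n i
Z-recurrence (suc n) (suc k) _ _ = sym (begin
  ℕ→ℚ (suc k) * ℕ→ℚ (Z (suc n) (suc k)) - correction (suc n) (suc k)
    ≡⟨ cong₂ _-_ (sym (ℕ→ℚ-* (suc k) (Z (suc n) (suc k)))) (correction≡endingAt k n) ⟩
  ℕ→ℚ (suc k ℕ.* Z (suc n) (suc k)) - ℕ→ℚ (k ℕ.* endingAt k n 1 1)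
    ≡⟨ cong (λ z → ℕ→ℚ z - ℕ→ℚ (k ℕ.* endingAt k n 1 1)) (Z-suc k n) ⟨
  ℕ→ℚ (Z (suc (suc n)) (suc k) ℕ.+ k ℕ.* endingAt k n 1 1) - ℕ→ℚ (k ℕ.* endingAt k n 1 1)
    ≡⟨ ℕ→ℚ-+-cancelʳ (Z (suc (suc n)) (suc k)) (k ℕ.* endingAt k n 1 1) ⟩
  ℕ→ℚ (Z (suc (suc n)) (suc k))
    ∎)
  where open ≡-Reasoning

Z-3 : ∀ i → 2 ≤ i → Z 3 i ≡ i
Z-3 (suc zero)    (s≤s ())
Z-3 (suc (suc k)) _ = trans (Z≡extensions 3 (suc (suc k))) (unfolded (suc k))
  where
  unfolded : ∀ k → 1 ℕ.+ k ℕ.* 1 ℕ.+ k ℕ.* 0 ℕ.+ k ℕ.* 0 ≡ suc k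
  unfolded = solve-∀

corollary3p5 : (n : ℕ) → 3 ≤ n →
    ((i : ℕ) → 2 ≤ i →
      ℕ→ℚ (Z n i) ≡ (ℕ→ℚ (i ∸ 1) ^ℚ m n) * fpoly n (recip (i ∸ 1)))
    × ((i : ℕ) → 2 ≤ i →
      ℕ→ℚ (Z (suc n) i) ≡ (ℕ→ℚ i * ℕ→ℚ (Z n i)) - correction n i)
    × ((i : ℕ) → 2 ≤ i → Z 3 i ≡ i)
corollary3p5 n 3≤n = Z-fpoly n , (λ i → Z-recurrence n i (ℕ.≤-trans (s≤s z≤n) 3≤n)) , Z-3
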